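{- Let $\lambda=(\lambda_1>\cdots>\lambda_d>0)$ be a strict partition, $N=|\lambda|$, $B\in\mathrm{BS}(\lambda)$, and fix $i\in\{1,\dots,d\}$ with either $i=1$ or $\lambda_{i-1}\ge\lambda_i+3$. Let $\lambda^\#$ be obtained from $\lambda$ by increasing $\lambda_i$ by $1$, and let $(i,j)$ (so $j=\lambda_i-d+i$) be the box of $D(\lambda^\#)\setminus D(\lambda)$. Let $B^\#$ be obtained from $B$ by (1) interchanging columns $j$ and $j+1$ of $B$ (i.e. swapping $B(a,j)$ and $B(a,j+1)$ in every row $a$ containing these columns), and (2) setting $B^\#(i,j)=N+1$. Then $B^\#$ is a balanced shifted tableau, and $B\mapsto B^\#$ is a bijection from $\mathrm{BS}(\lambda)$ onto $\{T\in\mathrm{BS}(\lambda^\#):T(i,j)=N+1\}$.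
   Context: Shifted diagram of a strict partition $\lambda=(\lambda_1>\cdots>\lambda_d>0)$: $D(\lambda)=\{(i,j-d+i-1):1\le i\le d,1\le j\le\lambda_i\}$ (row $i$ occupies columns $i-d,\dots,\lambda_i-d+i-1$; rows numbered top to bottom). $B(i,j)$ is the entry of box $(i,j)$. Balanced shifted tableaux: for $(i,j)\in D(\lambda)$ with $j\ge0$ the hook $H(i,j)$ is $(i,j)$ with the boxes of row $i$ to its right and of column $j$ below it; for $(i,-j)$, $j>0$, $H(i,-j)$ is $(i,-j)$, the boxes of row $i$ to its right, the boxes of column $-j$ below it, and all boxes of row $d-j+1$. The extended filling $\tilde B$ additionally puts $B(i,0)$ in the box $(i,-(d+1-i))$, $1\le i\le d$. Extended hook: $\tilde H(i,j)=H(i,j)$ for $j\ge0$, $\tilde H(i,-j)=H(i,-j)\cup\{(d+1-j,-j)\}$ for $j>0$. Rank: $\mathrm{rk}(i,j)=\lambda_i-d+i-j$ if $j\ge0$, $\lambda_i-d+i+\lambda_{d+1+j}+j+1$ if $j<0$. $\mathrm{BS}(\lambda)$ is the set of fillings $B$ of $D(\lambda)$ using each of $1,\dots,|\lambda|$ once such that for every $(i,j)\in D(\lambda)$ exactly $\mathrm{rk}(i,j)-1$ boxes of $\tilde H(i,j)$ carry an entry of $\tilde B$ larger than $B(i,j)$. -}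

module Defs where

open import Data.Bool using (Bool; true; false; if_then_else_; _∧_; _∨_)
open import Data.Nat as ℕ using (ℕ; zero; suc; _<_)
open import Data.Integer as ℤ using (ℤ; +_; _-_; _+_; 0ℤ; 1ℤ)
open import Data.List using (List; []; _∷_; map; concatMap; applyUpTo; upTo; filterᵇ; length; _++_)
open import Data.Nat.ListAction using (sum)
open import Data.List.Relation.Unary.All using (All)
open import Data.List.Relation.Unary.Linked using (Linked)
open import Data.List.Membership.Propositional using (_∈_)
open import Data.List.Relation.Binary.Permutation.Propositional using (_↭_)
open import Data.Product using (_×_; _,_; proj₁; proj₂)
open import Relation.Nullary.Decidable using (⌊_⌋)
open import Relation.Binary.PropositionalEquality using (_≡_)

Strict : List ℕ → Set
Strict la = Linked ℕ._>_ la × All (0 <_) la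

-- 1-based part λ_a (0 outside 1..d)
part : List ℕ → ℕ → ℕ
part []       _             = 0
part (x ∷ xs) zero          = 0
part (x ∷ xs) (suc zero)    = x
part (x ∷ xs) (suc (suc n)) = part xs (suc n)

size : List ℕ → ℕ
size = sum

incAt : List ℕ → ℕ → List ℕ
incAt []       _             = []
incAt (x ∷ xs) zero          = x ∷ xs
incAt (x ∷ xs) (suc zero)    = suc x ∷ xs
incAt (x ∷ xs) (suc (suc n)) = x ∷ incAt xs (suc n)

-- boxes (row a, column c); rows 1..d top to bottom, columns integers
Box : Set
Box = ℕ × ℤ

-- a filling: entries given as a total function; only values on D(λ) matter
Filling : Set
Filling = ℕ → ℤ → ℕ

-- D(λ): row a occupies columns a-d, …, λ_a-d+a-1
boxes : List ℕ → List Box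
boxes la = concatMap row (applyUpTo suc (length la))
  where
  row : ℕ → List Box
  row a = map (λ k → (a , (+ a - + length la) + + k)) (upTo (part la a))

inHook : List ℕ → ℕ → ℤ → Box → Bool
inHook la i c (a , e) with ⌊ 0ℤ ℤ.≤? c ⌋
... | true  = (⌊ a ℕ.≟ i ⌋ ∧ ⌊ c ℤ.≤? e ⌋) ∨ (⌊ e ℤ.≟ c ⌋ ∧ ⌊ i ℕ.<? a ⌋)
... | false = (⌊ a ℕ.≟ i ⌋ ∧ ⌊ c ℤ.≤? e ⌋) ∨ (⌊ e ℤ.≟ c ⌋ ∧ ⌊ i ℕ.<? a ⌋)
              ∨ ⌊ + a ℤ.≟ (+ suc (length la)) + c ⌋

-- extended hook H~(i , c) as a list of boxes:
-- H(i,c) (boxes of D(λ)), plus for c = -j < 0 the extra box (d+1-j , -j)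
hookTilde : List ℕ → ℕ → ℤ → List Box
hookTilde la i c with ⌊ 0ℤ ℤ.≤? c ⌋
... | true  = filterᵇ (inHook la i c) (boxes la)
... | false = filterᵇ (inHook la i c) (boxes la)
              ++ ((ℤ.∣ + suc (length la) + c ∣ , c) ∷ [])

tildeB : List ℕ → Filling → Box → ℕ
tildeB la B (a , e) =
  if ⌊ e ℤ.≟ (+ a - + length la) - 1ℤ ⌋ then B a 0ℤ else B a e

rk : List ℕ → ℕ → ℤ → ℤ
rk la i c with ⌊ 0ℤ ℤ.≤? c ⌋
... | true  = + part la i - + length la + + i - c
... | false = + part la i - + length la + + i
              + + part la (ℤ.∣ + suc (length la) + c ∣) + c + 1ℤ

largerCount : List ℕ → Filling → ℕ → ℤ → ℕ
largerCount la B i c =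
  length (filterᵇ (λ x → ⌊ B i c ℕ.<? tildeB la B x ⌋) (hookTilde la i c))

BS : List ℕ → Filling → Set
BS la B =
  (map (λ x → B (proj₁ x) (proj₂ x)) (boxes la) ↭ applyUpTo suc (size la))
  × (∀ a c → (a , c) ∈ boxes la → + largerCount la B a c ≡ rk la a c - 1ℤ)

_≈[_]_ : Filling → List ℕ → Filling → Set
B ≈[ la ] B' = ∀ a c → (a , c) ∈ boxes la → B a c ≡ B' a c

newCol : List ℕ → ℕ → ℤ
newCol la i = + part la i - + length la + + i

sharp : List ℕ → ℕ → Filling → Filling
sharp la i B a e =
  if ⌊ a ℕ.≟ i ⌋ ∧ ⌊ e ℤ.≟ j ⌋ then suc (size la)
  else if ⌊ e ℤ.≟ j ⌋ then B a (j + 1ℤ)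
  else if ⌊ e ℤ.≟ j + 1ℤ ⌋ then B a j
  else B a e
  where j = newCol la i

module Submission where

-- Rows above i reach columns j and
-- j+1 (this is where λ_{i-1} ≥ λ_i + 3 enters), rows from i on reach neither,
-- so swapping the two columns maps D(λ) onto itself and D(λ^#) = D(λ) ∪ {(i, j)}.
-- In a balanced B the rows above i ascend from column j to j+1: by downward
-- induction on the row, a descent would let the swap inject the larger entries
-- of H(a, j) into those of H(a, j+1), while the ranks demand one more at (a, j).
-- Given this, the swap exchanges the counts at (a, j) and (a, j+1) up to the new
-- entry N+1; the new box has rank 1 and no larger entry in its hook; any other
-- box gains N+1 in its hook exactly when its rank grows by one. Conversely,
-- swapping back is balanced: the same ascent follows from the balance of B^#
-- and the distinctness of the entries.

module Counting where

  open import Data.Bool using (Bool; true; false; _∧_)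
  open import Data.Nat using (ℕ; suc; _+_; _≤_; z≤n; s≤s)
  open import Data.Nat.Properties using (+-assoc; +-comm; +-suc; +-mono-≤; ≤-refl; ≤-trans; ≤-reflexive)
  open import Data.List using (List; []; _∷_; map; length; filterᵇ; _++_)
  open import Data.List.Membership.Propositional using (_∈_)
  open import Data.List.Relation.Unary.Any using (here; there)
  import Data.List.Relation.Unary.All as All
  open import Data.List.Relation.Unary.AllPairs using (_∷_)
  open import Data.List.Relation.Unary.Unique.Propositional using (Unique)
  open import Data.List.Relation.Binary.Permutation.Propositional as ↭ using (_↭_; prep; swap)
  open import Relation.Binary.PropositionalEquality

  indicator : Bool → ℕ
  indicator true  = 1
  indicator false = 0

  indicator-mono : ∀ a b → (a ≡ true → b ≡ true) → indicator a ≤ indicator b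
  indicator-mono false b h = z≤n
  indicator-mono true  b h rewrite h refl = ≤-refl

  count : {A : Set} → (A → Bool) → List A → ℕ
  count p []       = 0
  count p (x ∷ xs) = indicator (p x) + count p xs

  module _ {A : Set} where

    length-filterᵇ : ∀ p (xs : List A) → length (filterᵇ p xs) ≡ count p xs
    length-filterᵇ p [] = refl
    length-filterᵇ p (x ∷ xs) with p x
    ... | true  = cong suc (length-filterᵇ p xs)
    ... | false = length-filterᵇ p xs

    count-filterᵇ : ∀ p q (xs : List A) → count q (filterᵇ p xs) ≡ count (λ x → p x ∧ q x) xs
    count-filterᵇ p q [] = refl
    count-filterᵇ p q (x ∷ xs) with p x
    ... | true  = cong (indicator (q x) +_) (count-filterᵇ p q xs)
    ... | false = count-filterᵇ p q xs

    count-++ : ∀ p (xs ys : List A) → count p (xs ++ ys) ≡ count p xs + count p ys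
    count-++ p []       ys = refl
    count-++ p (x ∷ xs) ys =
      trans (cong (indicator (p x) +_) (count-++ p xs ys)) (sym (+-assoc (indicator (p x)) _ _))

    count-↭ : ∀ p {xs ys : List A} → xs ↭ ys → count p xs ≡ count p ys
    count-↭ p ↭.refl          = refl
    count-↭ p (prep x q)      = cong (indicator (p x) +_) (count-↭ p q)
    count-↭ p (swap {xs} {ys} x y q) = begin
      indicator (p x) + (indicator (p y) + count p xs) ≡⟨ sym (+-assoc (indicator (p x)) _ _) ⟩
      (indicator (p x) + indicator (p y)) + count p xs ≡⟨ cong₂ _+_ (+-comm (indicator (p x)) _) (count-↭ p q) ⟩
      (indicator (p y) + indicator (p x)) + count p ys ≡⟨ +-assoc (indicator (p y)) _ _ ⟩
      indicator (p y) + (indicator (p x) + count p ys) ∎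
      where open ≡-Reasoning
    count-↭ p (↭.trans q r)   = trans (count-↭ p q) (count-↭ p r)

    count-map : ∀ {C : Set} (p : C → Bool) (f : A → C) (xs : List A) →
                count p (map f xs) ≡ count (λ x → p (f x)) xs
    count-map p f []       = refl
    count-map p f (x ∷ xs) = cong (indicator (p (f x)) +_) (count-map p f xs)

    count-cong : ∀ p q (xs : List A) → (∀ x → x ∈ xs → p x ≡ q x) → count p xs ≡ count q xs
    count-cong p q []       h = refl
    count-cong p q (x ∷ xs) h =
      cong₂ _+_ (cong indicator (h x (here refl))) (count-cong p q xs (λ y m → h y (there m)))

    count-false : ∀ p (xs : List A) → (∀ x → x ∈ xs → p x ≡ false) → count p xs ≡ 0
    count-false p []       h = refl
    count-false p (x ∷ xs) h rewrite h x (here refl) = count-false p xs (λ y m → h y (there m))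

    count-mono : ∀ p q (xs : List A) → (∀ x → x ∈ xs → p x ≡ true → q x ≡ true) →
                 count p xs ≤ count q xs
    count-mono p q []       h = z≤n
    count-mono p q (x ∷ xs) h =
      +-mono-≤ (indicator-mono (p x) (q x) (h x (here refl))) (count-mono p q xs (λ y m → h y (there m)))

    count-mono-< : ∀ p q (xs : List A) z → (∀ x → x ∈ xs → p x ≡ true → q x ≡ true) →
                   z ∈ xs → p z ≡ false → q z ≡ true → suc (count p xs) ≤ count q xs
    count-mono-< p q (x ∷ xs) z h (here refl) pz qz rewrite pz | qz =
      s≤s (count-mono p q xs (λ y m → h y (there m)))
    count-mono-< p q (x ∷ xs) z h (there m) pz qz =
      ≤-trans (≤-reflexive (sym (+-suc (indicator (p x)) (count p xs))))
        (+-mono-≤ (indicator-mono (p x) (q x) (h x (here refl)))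
                  (count-mono-< p q xs z (λ y m′ → h y (there m′)) m pz qz))

    count-differ-at-one : ∀ p q (xs : List A) z → Unique xs → z ∈ xs →
                          (∀ x → x ∈ xs → x ≢ z → q x ≡ p x) → p z ≡ false → q z ≡ true →
                          count q xs ≡ suc (count p xs)
    count-differ-at-one p q (x ∷ xs) z (x∉xs ∷ u) (here refl) h pz qz rewrite pz | qz =
      cong suc (count-cong q p xs (λ y m → h y (there m) (λ e → All.lookup x∉xs m (sym e))))
    count-differ-at-one p q (x ∷ xs) z (x∉xs ∷ u) (there m) h pz qz
      rewrite h x (here refl) (λ e → All.lookup x∉xs m e) =
      trans (cong (indicator (p x) +_) (count-differ-at-one p q xs z u m (λ y m′ → h y (there m′)) pz qz))
            (+-suc _ _)

module Uniqueness where

  open import Data.List using (List; _∷_; map)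
  open import Data.List.Membership.Propositional using (_∈_)
  open import Data.List.Membership.Propositional.Properties using (∈-map⁺)
  open import Data.List.Membership.Propositional.Properties.WithK using (unique∧set⇒bag)
  open import Data.List.Relation.Binary.BagAndSetEquality using (∼bag⇒↭)
  open import Data.List.Relation.Unary.Any using (here; there)
  import Data.List.Relation.Unary.All as All
  open import Data.List.Relation.Unary.AllPairs using (_∷_)
  open import Data.List.Relation.Unary.Unique.Propositional using (Unique)
  open import Data.List.Relation.Binary.Permutation.Propositional using (_↭_; ↭⇒↭ₛ)
  import Data.List.Relation.Binary.Permutation.Setoid.Properties as ↭ₛ
  open import Data.Empty using (⊥-elim)
  open import Function.Bundles using (mk⇔)
  open import Relation.Binary.PropositionalEquality

  module _ {A : Set} where

    unique-same-elements⇒↭ : ∀ {xs ys : List A} → Unique xs → Unique ys →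
                             (∀ {x} → x ∈ xs → x ∈ ys) → (∀ {x} → x ∈ ys → x ∈ xs) → xs ↭ ys
    unique-same-elements⇒↭ ux uy f g = ∼bag⇒↭ (unique∧set⇒bag ux uy (mk⇔ f g))

    Unique-resp-↭ : ∀ {xs ys : List A} → xs ↭ ys → Unique xs → Unique ys
    Unique-resp-↭ p = ↭ₛ.Unique-resp-↭ (setoid A) (↭⇒↭ₛ p)

    unique-map⇒injective-on : ∀ {B : Set} (f : A → B) (xs : List A) {x y} →
                              Unique (map f xs) → x ∈ xs → y ∈ xs → f x ≡ f y → x ≡ y
    unique-map⇒injective-on f (z ∷ xs) (_ ∷ _)  (here refl) (here refl) e = refl
    unique-map⇒injective-on f (z ∷ xs) (fz∉ ∷ _) (here refl) (there y∈) e = ⊥-elim (All.lookup fz∉ (∈-map⁺ f y∈) e)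
    unique-map⇒injective-on f (z ∷ xs) (fz∉ ∷ _) (there x∈) (here refl) e = ⊥-elim (All.lookup fz∉ (∈-map⁺ f x∈) (sym e))
    unique-map⇒injective-on f (z ∷ xs) (_ ∷ u)  (there x∈) (there y∈) e = unique-map⇒injective-on f xs u x∈ y∈ e

module Decisions where

  open import Data.Bool using (true; false; if_then_else_; _∧_; _∨_)
  open import Data.Product using (_×_; _,_)
  open import Data.Sum using (_⊎_; inj₁; inj₂)
  open import Function.Bundles using (_⇔_; Equivalence)
  open import Relation.Nullary using (¬_; Dec; yes; no)
  open import Relation.Nullary.Decidable using (⌊_⌋; isYes≗does; dec-true; dec-false)
  open import Relation.Binary.PropositionalEquality

  isYes-true : ∀ {P : Set} (p : Dec P) → P → ⌊ p ⌋ ≡ true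
  isYes-true p x = trans (isYes≗does p) (dec-true p x)

  isYes-false : ∀ {P : Set} (p : Dec P) → ¬ P → ⌊ p ⌋ ≡ false
  isYes-false p ¬x = trans (isYes≗does p) (dec-false p ¬x)

  isYes-witness : ∀ {P : Set} (p : Dec P) → ⌊ p ⌋ ≡ true → P
  isYes-witness (yes x) _ = x

  ∧-true : ∀ u v → (u ∧ v) ≡ true → u ≡ true × v ≡ true
  ∧-true true true _ = refl , refl

  ∨-true : ∀ u v → (u ∨ v) ≡ true → u ≡ true ⊎ v ≡ true
  ∨-true true  v _ = inj₁ refl
  ∨-true false v e = inj₂ e

  if-true : ∀ {A : Set} {b} {x y : A} → b ≡ true → (if b then x else y) ≡ x
  if-true refl = refl

  if-false : ∀ {A : Set} {b} {x y : A} → b ≡ false → (if b then x else y) ≡ y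
  if-false refl = refl

  isYes-cong : ∀ {P Q : Set} → P ⇔ Q → (p : Dec P) (q : Dec Q) → ⌊ p ⌋ ≡ ⌊ q ⌋
  isYes-cong P⇔Q (yes x) q = sym (isYes-true q (Equivalence.to P⇔Q x))
  isYes-cong P⇔Q (no ¬x) q = sym (isYes-false q (λ y → ¬x (Equivalence.from P⇔Q y)))

module Column where

  open import Data.Nat as ℕ using (ℕ; suc)
  open import Data.Nat.Properties as ℕ using ()
  open import Data.Integer as ℤ using (ℤ; +_; _-_; _+_; 0ℤ; 1ℤ; -_)
  open import Data.Integer.Properties as ℤ using ()
  open import Data.Integer.Tactic.RingSolver using (solve-∀)
  open import Function.Bundles using (mk⇔)
  open import Relation.Nullary.Decidable using (⌊_⌋)
  open import Relation.Binary.PropositionalEquality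
  open Decisions

  -- Boxes are located by their shifted position s = a + k (k-th box of row a),
  -- whose column in D(λ) is s − d.
  col : ℕ → ℕ → ℤ
  col d s = + s - + d

  col-+ : ∀ d a k → (+ a - + d) + + k ≡ col d (a ℕ.+ k)
  col-+ d a k = trans (reorder (+ a) (+ k) (+ d)) (cong (_- + d) (sym (ℤ.pos-+ a k)))
    where
    reorder : ∀ (a k d : ℤ) → (a - d) + k ≡ (a + k) - d
    reorder = solve-∀

  col-suc : ∀ d s → col d s + 1ℤ ≡ col d (suc s)
  col-suc d s = trans (reorder (+ s) (+ d)) (cong (λ z → + z - + d) (ℕ.+-comm s 1))
    where
    reorder : ∀ (s d : ℤ) → (s - d) + 1ℤ ≡ (s + 1ℤ) - d
    reorder = solve-∀

  col-+d : ∀ d s → col d s + + d ≡ + s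
  col-+d d s = cancel (+ s) (+ d)
    where
    cancel : ∀ (s d : ℤ) → (s - d) + d ≡ s
    cancel = solve-∀

  suc-d+col : ∀ d s → + suc d + col d s ≡ + suc s
  suc-d+col d s = cancel (+ s) (+ d)
    where
    cancel : ∀ (s d : ℤ) → (1ℤ + d) + (s - d) ≡ 1ℤ + s
    cancel = solve-∀

  col-self : ∀ d → col d d ≡ 0ℤ
  col-self d = ℤ.+-inverseʳ (+ d)

  col-injective : ∀ d {s t} → col d s ≡ col d t → s ≡ t
  col-injective d {s} {t} e = ℤ.+-injective (trans (sym (col-+d d s)) (trans (cong (_+ + d) e) (col-+d d t)))

  col-mono-≤ : ∀ d {s t} → s ℕ.≤ t → col d s ℤ.≤ col d t
  col-mono-≤ d le = ℤ.+-monoˡ-≤ (- + d) (ℤ.+≤+ le)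

  col-cancel-≤ : ∀ d {s t} → col d s ℤ.≤ col d t → s ℕ.≤ t
  col-cancel-≤ d {s} {t} le = ℤ.drop‿+≤+ (subst₂ ℤ._≤_ (col-+d d s) (col-+d d t) (ℤ.+-monoˡ-≤ (+ d) le))

  isYes-col-≟ : ∀ d s t → ⌊ col d s ℤ.≟ col d t ⌋ ≡ ⌊ s ℕ.≟ t ⌋
  isYes-col-≟ d s t = isYes-cong (mk⇔ (col-injective d) (cong (col d))) _ _

  isYes-col-≤? : ∀ d s t → ⌊ col d s ℤ.≤? col d t ⌋ ≡ ⌊ s ℕ.≤? t ⌋
  isYes-col-≤? d s t = isYes-cong (mk⇔ (col-cancel-≤ d) (col-mono-≤ d)) _ _

  isYes-0≤col : ∀ d s → ⌊ 0ℤ ℤ.≤? col d s ⌋ ≡ ⌊ d ℕ.≤? s ⌋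
  isYes-0≤col d s = trans (cong (λ z → ⌊ z ℤ.≤? col d s ⌋) (sym (col-self d))) (isYes-col-≤? d d s)

module Diagram where

  open import Defs
  open import Data.Nat as ℕ using (ℕ; suc; z≤n; s≤s; _≤_; _<_)
  open import Data.Nat.Properties as ℕ using ()
  open import Data.Integer using (ℤ; +_; _-_; _+_)
  open import Data.List using (List; []; _∷_; map; concatMap; applyUpTo; upTo; length)
  open import Data.List.Membership.Propositional using (_∈_)
  open import Data.List.Membership.Propositional.Properties
    using (∈-map⁺; ∈-map⁻; ∈-++⁻; ∈-concatMap⁺; ∈-concatMap⁻; ∈-upTo⁺; ∈-upTo⁻)
  open import Data.List.Relation.Unary.Any using (here; there)
  import Data.List.Relation.Unary.Any.Properties as Any
  import Data.List.Relation.Unary.All as All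
  open import Data.List.Relation.Unary.AllPairs using ([]; _∷_)
  open import Data.Empty using (⊥)
  open import Data.List.Relation.Unary.Unique.Propositional using (Unique)
  import Data.List.Relation.Unary.Unique.Propositional.Properties as Unique
  open import Data.Product using (_×_; _,_; proj₁; proj₂)
  open import Data.Sum using (inj₁; inj₂)
  open import Relation.Binary.PropositionalEquality
  open Column

  record Cell (la : List ℕ) (b : ℕ) (e : ℤ) : Set where
    constructor cell
    field
      shifted   : ℕ
      1≤row     : 1 ≤ b
      row≤d     : b ≤ length la
      row≤shift : b ≤ shifted
      shift<end : shifted < b ℕ.+ part la b
      column    : e ≡ col (length la) shifted

  private
    row : List ℕ → ℕ → List Box
    row la a = map (λ k → (a , (+ a - + length la) + + k)) (upTo (part la a))

    row-∈⁻ : ∀ {la a v} → v ∈ row la a → proj₁ v ≡ a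
    row-∈⁻ {la} {a} m with ∈-map⁻ (λ k → (a , (+ a - + length la) + + k)) m
    ... | _ , _ , refl = refl

    rows-∈⁻ : ∀ {la} (rs : List ℕ) {v} → v ∈ concatMap (row la) rs → proj₁ v ∈ rs
    rows-∈⁻ {la} (r ∷ rs) m with ∈-++⁻ (row la r) m
    ... | inj₁ m′ = here (row-∈⁻ {la} m′)
    ... | inj₂ m′ = there (rows-∈⁻ {la} rs m′)

    row-unique : ∀ la a → Unique (row la a)
    row-unique la a = Unique.map⁺ shift-injective (Unique.upTo⁺ (part la a))
      where
      d = length la
      shift-injective : ∀ {x y} → (a , (+ a - + d) + + x) ≡ (a , (+ a - + d) + + y) → x ≡ y
      shift-injective {x} {y} e = ℕ.+-cancelˡ-≡ a x y
        (col-injective d (trans (sym (col-+ d a x)) (trans (cong proj₂ e) (col-+ d a y))))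

    rows-unique : ∀ la (rs : List ℕ) → Unique rs → Unique (concatMap (row la) rs)
    rows-unique la []       u        = []
    rows-unique la (r ∷ rs) (r∉ ∷ u) = Unique.++⁺ (row-unique la r) (rows-unique la rs u) disjoint
      where
      disjoint : ∀ {v} → (v ∈ row la r × v ∈ concatMap (row la) rs) → ⊥
      disjoint (m₁ , m₂) = All.lookup r∉ (subst (_∈ rs) (row-∈⁻ {la} m₁) (rows-∈⁻ {la} rs m₂)) refl

  boxes-∈⁻ : ∀ la {b e} → (b , e) ∈ boxes la → Cell la b e
  boxes-∈⁻ la m with Any.applyUpTo⁻ suc (∈-concatMap⁻ (row la) {xs = applyUpTo suc (length la)} m)
  ... | k , k<d , m′ with ∈-map⁻ (λ q → (suc k , (+ suc k - + length la) + + q)) m′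
  ... | q , q∈ , refl = cell (suc k ℕ.+ q) (s≤s z≤n) k<d (ℕ.m≤m+n (suc k) q)
                             (ℕ.+-monoʳ-< (suc k) (∈-upTo⁻ q∈)) (col-+ (length la) (suc k) q)

  boxes-∈⁺ : ∀ la {b e} → Cell la b e → (b , e) ∈ boxes la
  boxes-∈⁺ la {suc b} (cell s _ b<d b<s s<end refl) =
    ∈-concatMap⁺ (row la) {xs = applyUpTo suc (length la)}
      (Any.applyUpTo⁺ suc (subst (λ z → (suc b , z) ∈ row la (suc b)) column
        (∈-map⁺ (λ q → (suc b , (+ suc b - + length la) + + q)) (∈-upTo⁺ k<part))) b<d)
    where
    k = s ℕ.∸ suc b
    column : (+ suc b - + length la) + + k ≡ col (length la) s
    column = trans (col-+ (length la) (suc b) k) (cong (col (length la)) (ℕ.m+[n∸m]≡n b<s))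
    k<part : k < part la (suc b)
    k<part = ℕ.+-cancelˡ-< (suc b) _ _ (subst (_< suc b ℕ.+ part la (suc b)) (sym (ℕ.m+[n∸m]≡n b<s)) s<end)

  boxes-unique : ∀ la → Unique (boxes la)
  boxes-unique la = rows-unique la (applyUpTo suc (length la))
    (Unique.applyUpTo⁺₁ suc (length la) (λ i<j _ e → ℕ.<⇒≢ i<j (ℕ.suc-injective e)))

  entry : Filling → Box → ℕ
  entry F x = F (proj₁ x) (proj₂ x)

module StrictPartition where

  open import Defs
  open import Data.Nat using (ℕ; zero; suc; z≤n; s≤s; _≤_; _<_; _+_; _∸_)
  open import Data.Nat.Properties
  open import Data.Nat.Tactic.RingSolver using (solve-∀)
  open import Data.List using (List; []; _∷_; length)
  open import Data.List.Relation.Unary.All using (_∷_)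
  open import Data.List.Relation.Unary.Linked using (_∷_)
  open import Data.Product using (_,_)
  open import Data.Sum using (_⊎_; inj₁; inj₂)
  open import Data.Empty using (⊥-elim)
  open import Relation.Binary.PropositionalEquality

  -- One past the shifted position of the last box of row b.
  rowEnd : List ℕ → ℕ → ℕ
  rowEnd la b = part la b + b

  part-positive : ∀ la → Strict la → ∀ b → 1 ≤ b → b ≤ length la → 1 ≤ part la b
  part-positive (x ∷ xs)     (_ , x>0 ∷ _)    1             _ _          = x>0
  part-positive (x ∷ y ∷ xs) (_ ∷ l , _ ∷ a)  (suc (suc b)) _ (s≤s b≤d) =
    part-positive (y ∷ xs) (l , a) (suc b) (s≤s z≤n) b≤d

  part-suc< : ∀ la → Strict la → ∀ b → 1 ≤ b → suc b ≤ length la → part la (suc b) < part la b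
  part-suc< (x ∷ [])     _              1             _ (s≤s ())
  part-suc< (x ∷ y ∷ xs) (x>y ∷ _ , _)  1             _ _          = x>y
  part-suc< (x ∷ y ∷ xs) (_ ∷ l , _ ∷ a) (suc (suc b)) _ (s≤s b<d) =
    part-suc< (y ∷ xs) (l , a) (suc b) (s≤s z≤n) b<d

  rowEnd-antitone : ∀ la → Strict la → ∀ {b c} → 1 ≤ b → b ≤ c → c ≤ length la → rowEnd la c ≤ rowEnd la b
  rowEnd-antitone la st {b} 1≤b b≤c c≤d with m≤n⇒∃[o]m+o≡n b≤c
  ... | o , refl = go o c≤d
    where
    go : ∀ o → b + o ≤ length la → rowEnd la (b + o) ≤ rowEnd la b
    go zero    _ rewrite +-identityʳ b = ≤-refl
    go (suc o) le rewrite +-suc b o = begin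
      part la (suc (b + o)) + suc (b + o)   ≡⟨ +-suc _ _ ⟩
      suc (part la (suc (b + o))) + (b + o) ≤⟨ +-monoˡ-≤ (b + o) (part-suc< la st (b + o) (≤-trans 1≤b (m≤m+n b o)) le) ⟩
      rowEnd la (b + o)                     ≤⟨ go o (≤-trans (n≤1+n (b + o)) le) ⟩
      rowEnd la b                           ∎
      where open ≤-Reasoning

  -- The hypothesis λ_{i-1} ≥ λ_i + 3 makes every row above row i reach at
  -- least two boxes past the new box (i, j), i.e. cover columns j and j+1.
  rowEnd-gap : ∀ la → Strict la → ∀ i → i ≤ length la → (i ≡ 1 ⊎ part la i + 3 ≤ part la (i ∸ 1)) →
               ∀ b → 1 ≤ b → b < i → 2 + rowEnd la i ≤ rowEnd la b
  rowEnd-gap la st 1 _ (inj₁ refl) (suc _) _ (s≤s ())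
  rowEnd-gap la st (suc i′) i≤d (inj₂ gap) b 1≤b (s≤s b≤i′) = begin
    2 + (part la (suc i′) + suc i′) ≡⟨ reorder (part la (suc i′)) i′ ⟩
    part la (suc i′) + 3 + i′       ≤⟨ +-monoˡ-≤ i′ gap ⟩
    rowEnd la i′                    ≤⟨ rowEnd-antitone la st 1≤b b≤i′ (≤-trans (n≤1+n i′) i≤d) ⟩
    rowEnd la b                     ∎
    where
    open ≤-Reasoning
    reorder : ∀ x y → 2 + (x + suc y) ≡ x + 3 + y
    reorder = solve-∀

  length-incAt : ∀ la i → length (incAt la i) ≡ length la
  length-incAt []       i             = refl
  length-incAt (x ∷ xs) zero          = refl
  length-incAt (x ∷ xs) 1             = refl
  length-incAt (x ∷ xs) (suc (suc i)) = cong suc (length-incAt xs (suc i))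

  part-incAt-≢ : ∀ la i b → b ≢ i → part (incAt la i) b ≡ part la b
  part-incAt-≢ []       i             b             _   = refl
  part-incAt-≢ (x ∷ xs) zero          b             _   = refl
  part-incAt-≢ (x ∷ xs) 1             zero          _   = refl
  part-incAt-≢ (x ∷ xs) 1             1             b≢i = ⊥-elim (b≢i refl)
  part-incAt-≢ (x ∷ xs) 1             (suc (suc b)) _   = refl
  part-incAt-≢ (x ∷ xs) (suc (suc i)) zero          _   = refl
  part-incAt-≢ (x ∷ xs) (suc (suc i)) 1             _   = refl
  part-incAt-≢ (x ∷ xs) (suc (suc i)) (suc (suc b)) b≢i =
    part-incAt-≢ xs (suc i) (suc b) (λ e → b≢i (cong suc e))

  part-incAt-≡ : ∀ la i → 1 ≤ i → i ≤ length la → part (incAt la i) i ≡ suc (part la i)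
  part-incAt-≡ (x ∷ xs) 1             _ _         = refl
  part-incAt-≡ (x ∷ xs) (suc (suc i)) _ (s≤s i≤d) = part-incAt-≡ xs (suc i) (s≤s z≤n) i≤d

  size-incAt : ∀ la i → 1 ≤ i → i ≤ length la → size (incAt la i) ≡ suc (size la)
  size-incAt (x ∷ xs) 1             _ _         = refl
  size-incAt (x ∷ xs) (suc (suc i)) _ (s≤s i≤d) =
    trans (cong (x +_) (size-incAt xs (suc i) (s≤s z≤n) i≤d)) (+-suc x _)

module BoundedInduction where

  open import Data.Nat using (ℕ; zero; suc; _≤_; _<_; _∸_)
  open import Data.Nat.Properties
  open import Data.Empty using (⊥-elim)
  open import Relation.Binary.PropositionalEquality

  downward-induction : ∀ {P : ℕ → Set} i →
    (∀ a → 1 ≤ a → a < i → (∀ b → a < b → b < i → P b) → P a) → ∀ a → 1 ≤ a → a < i → P a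
  downward-induction {P} i step a 1≤a a<i = go (i ∸ a) a 1≤a a<i ≤-refl
    where
    go : ∀ n a → 1 ≤ a → a < i → i ∸ a ≤ n → P a
    go zero    a 1≤a a<i le = ⊥-elim (<-irrefl refl (<-≤-trans (m<n⇒0<n∸m a<i) le))
    go (suc n) a 1≤a a<i le = step a 1≤a a<i λ b a<b b<i →
      go n b (≤-trans 1≤a (<⇒≤ a<b)) b<i (≤-pred (≤-trans (∸-monoʳ-< a<b (<⇒≤ b<i)) le))

module Hooks where

  open import Defs
  open import Data.Bool using (Bool; true; false; if_then_else_; _∧_; _∨_)
  open import Data.Bool.Properties using (∧-identityʳ; ∧-zeroʳ; ∨-identityʳ)
  open import Data.Nat as ℕ using (ℕ; suc)
  open import Data.Nat.Properties as ℕ using ()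
  open import Data.Integer as ℤ using (+_; _+_; 0ℤ)
  open import Data.Integer.Properties as ℤ using ()
  open import Data.List using (length)
  open import Data.Product using (_,_)
  open import Function.Bundles using (mk⇔)
  open import Relation.Nullary.Decidable using (⌊_⌋)
  open import Relation.Binary.PropositionalEquality
  open Decisions
  open Column

  -- inHook read in shifted positions: (b, t) lies in the hook of (a, s).
  -- The last disjunct is the row d+1−j of a hook H(a, −j).
  inArm inLeg : ℕ → ℕ → ℕ → ℕ → Bool
  inArm a s b t = ⌊ b ℕ.≟ a ⌋ ∧ ⌊ s ℕ.≤? t ⌋
  inLeg a s b t = ⌊ t ℕ.≟ s ⌋ ∧ ⌊ a ℕ.<? b ⌋

  inHookℕ : ℕ → ℕ → ℕ → ℕ → ℕ → Bool
  inHookℕ d a s b t =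
    if ⌊ d ℕ.≤? s ⌋ then inArm a s b t ∨ inLeg a s b t
    else inArm a s b t ∨ (inLeg a s b t ∨ ⌊ b ℕ.≟ suc s ⌋)

  inHook-nonneg : ∀ lb a c b e → ⌊ 0ℤ ℤ.≤? c ⌋ ≡ true →
    inHook lb a c (b , e) ≡ (⌊ b ℕ.≟ a ⌋ ∧ ⌊ c ℤ.≤? e ⌋) ∨ (⌊ e ℤ.≟ c ⌋ ∧ ⌊ a ℕ.<? b ⌋)
  inHook-nonneg lb a c b e eq with ⌊ 0ℤ ℤ.≤? c ⌋
  inHook-nonneg lb a c b e refl | true = refl

  inHook-neg : ∀ lb a c b e → ⌊ 0ℤ ℤ.≤? c ⌋ ≡ false →
    inHook lb a c (b , e) ≡ (⌊ b ℕ.≟ a ⌋ ∧ ⌊ c ℤ.≤? e ⌋) ∨ ((⌊ e ℤ.≟ c ⌋ ∧ ⌊ a ℕ.<? b ⌋)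
                            ∨ ⌊ + b ℤ.≟ + suc (length lb) + c ⌋)
  inHook-neg lb a c b e eq with ⌊ 0ℤ ℤ.≤? c ⌋
  inHook-neg lb a c b e refl | false = refl

  inHook-col : ∀ lb a s b t → let d = length lb in
               inHook lb a (col d s) (b , col d t) ≡ inHookℕ d a s b t
  inHook-col lb a s b t with ⌊ length lb ℕ.≤? s ⌋ in d≤s
  ... | true = trans (inHook-nonneg lb a _ b _ (trans (isYes-0≤col (length lb) s) d≤s))
                     (cong₂ (λ u v → (⌊ b ℕ.≟ a ⌋ ∧ u) ∨ (v ∧ ⌊ a ℕ.<? b ⌋))
                            (isYes-col-≤? (length lb) s t) (isYes-col-≟ (length lb) t s))
  ... | false = trans (inHook-neg lb a _ b _ (trans (isYes-0≤col (length lb) s) d≤s))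
                      (cong₃ (isYes-col-≤? (length lb) s t) (isYes-col-≟ (length lb) t s)
                             (trans (cong (λ z → ⌊ + b ℤ.≟ z ⌋) (suc-d+col (length lb) s))
                                    (isYes-cong (mk⇔ ℤ.+-injective (cong (+_))) _ _)))
    where
    cong₃ : ∀ {u u′ v v′ w w′} → u ≡ u′ → v ≡ v′ → w ≡ w′ →
            (⌊ b ℕ.≟ a ⌋ ∧ u) ∨ ((v ∧ ⌊ a ℕ.<? b ⌋) ∨ w) ≡ (⌊ b ℕ.≟ a ⌋ ∧ u′) ∨ ((v′ ∧ ⌊ a ℕ.<? b ⌋) ∨ w′)
    cong₃ refl refl refl = refl

  inHook-length : ∀ lb lb′ → length lb ≡ length lb′ → ∀ a c x → inHook lb a c x ≡ inHook lb′ a c x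
  inHook-length lb lb′ d≡d′ a c (b , e) with ⌊ 0ℤ ℤ.≤? c ⌋
  ... | true  = refl
  ... | false = cong (λ d → (⌊ b ℕ.≟ a ⌋ ∧ ⌊ c ℤ.≤? e ⌋) ∨ (⌊ e ℤ.≟ c ⌋ ∧ ⌊ a ℕ.<? b ⌋) ∨ ⌊ + b ℤ.≟ + suc d + c ⌋) d≡d′

  module _ {d s : ℕ} (d≤s : d ℕ.≤ s) (a b : ℕ) where

    inHookℕ-nonneg : ∀ t → inHookℕ d a s b t ≡ inArm a s b t ∨ inLeg a s b t
    inHookℕ-nonneg t = if-true (isYes-true (d ℕ.≤? s) d≤s)

    inHookℕ-same-col : inHookℕ d a s b s ≡ ⌊ b ℕ.≟ a ⌋ ∨ ⌊ a ℕ.<? b ⌋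
    inHookℕ-same-col rewrite inHookℕ-nonneg s | isYes-true (s ℕ.≤? s) ℕ.≤-refl | isYes-true (s ℕ.≟ s) refl =
      cong (_∨ ⌊ a ℕ.<? b ⌋) (∧-identityʳ _)

    inHookℕ-next-col : inHookℕ d a s b (suc s) ≡ ⌊ b ℕ.≟ a ⌋
    inHookℕ-next-col rewrite inHookℕ-nonneg (suc s) | isYes-true (s ℕ.≤? suc s) (ℕ.n≤1+n s)
                           | isYes-false (suc s ℕ.≟ s) ℕ.1+n≢n =
      trans (∨-identityʳ _) (∧-identityʳ _)

    inHookℕ-off-col : ∀ t → t ≢ s → inHookℕ d a s b t ≡ inArm a s b t
    inHookℕ-off-col t t≢s rewrite inHookℕ-nonneg t | isYes-false (t ℕ.≟ s) t≢s = ∨-identityʳ _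

  inHookℕ-prev-col : ∀ {d s} → d ℕ.≤ s → ∀ a b → inHookℕ d a (suc s) b s ≡ false
  inHookℕ-prev-col {d} {s} d≤s a b
    rewrite inHookℕ-nonneg (ℕ.m≤n⇒m≤1+n d≤s) a b s | isYes-false (suc s ℕ.≤? s) (ℕ.<-irrefl refl)
          | isYes-false (s ℕ.≟ suc s) (≢-sym ℕ.1+n≢n) =
    trans (∨-identityʳ _) (∧-zeroʳ ⌊ b ℕ.≟ a ⌋)

  inArm-suc : ∀ a s b t → t ≢ s → inArm a s b t ≡ inArm a (suc s) b t
  inArm-suc a s b t t≢s =
    cong (⌊ b ℕ.≟ a ⌋ ∧_) (isYes-cong (mk⇔ (λ s≤t → ℕ.≤∧≢⇒< s≤t (≢-sym t≢s)) ℕ.<⇒≤) _ _)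

  inHookℕ-swap-cols : ∀ d a s b t → s ≢ t → s ≢ suc t → inHookℕ d a s b t ≡ inHookℕ d a s b (suc t)
  inHookℕ-swap-cols d a s b t s≢t s≢t+1 =
    cong₂ (λ u v → if ⌊ d ℕ.≤? s ⌋ then u ∨ v else u ∨ (v ∨ ⌊ b ℕ.≟ suc s ⌋)) arm leg
    where
    arm : inArm a s b t ≡ inArm a s b (suc t)
    arm = cong (⌊ b ℕ.≟ a ⌋ ∧_)
      (isYes-cong (mk⇔ (λ s≤t → ℕ.≤-trans s≤t (ℕ.n≤1+n t)) (λ s≤t+1 → ℕ.≤-pred (ℕ.≤∧≢⇒< s≤t+1 s≢t+1))) _ _)
    leg : inLeg a s b t ≡ inLeg a s b (suc t)
    leg = trans (cong (_∧ ⌊ a ℕ.<? b ⌋) (isYes-false (t ℕ.≟ s) (≢-sym s≢t)))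
                (sym (cong (_∧ ⌊ a ℕ.<? b ⌋) (isYes-false (suc t ℕ.≟ s) (≢-sym s≢t+1))))

module Balance where

  open import Defs
  open import Data.Bool using (Bool; true; false; if_then_else_; _∧_)
  open import Data.Nat as ℕ using (ℕ; suc; s≤s)
  open import Data.Nat.Properties as ℕ using ()
  open import Data.Integer as ℤ using (ℤ; +_; _-_; _+_; 0ℤ; 1ℤ)
  open import Data.Integer.Properties as ℤ using ()
  open import Data.Integer.Tactic.RingSolver using (solve-∀)
  open import Data.List using (List; []; _∷_; filterᵇ; length; _++_)
  open import Data.List.Properties using (++-identityʳ)
  open import Data.List.Membership.Propositional using (_∈_)
  open import Data.Product using (_,_)
  open import Function.Bundles using (_⇔_; mk⇔)
  open import Relation.Nullary using (¬_)
  open import Relation.Nullary.Decidable using (⌊_⌋)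
  open import Relation.Binary.PropositionalEquality
  open Counting
  open Decisions
  open Column
  open Diagram
  open Hooks

  largerInD : List ℕ → Filling → ℕ → ℤ → ℕ
  largerInD lb F a c = count (λ x → inHook lb a c x ∧ ⌊ F a c ℕ.<? entry F x ⌋) (boxes lb)

  -- Contribution of the box (d+1−j, −j) that H~(a, −j) adds to H(a, −j).
  largerExtra : List ℕ → Filling → ℕ → ℤ → ℕ
  largerExtra lb F a c =
    if ⌊ 0ℤ ℤ.≤? c ⌋ then 0
    else indicator ⌊ F a c ℕ.<? tildeB lb F (ℤ.∣ + suc (length lb) + c ∣ , c) ⌋

  private
    filterᵇ-cong : ∀ {A : Set} {p q : A → Bool} xs → (∀ x → p x ≡ q x) → filterᵇ p xs ≡ filterᵇ q xs
    filterᵇ-cong []       h = refl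
    filterᵇ-cong {p = p} {q} (x ∷ xs) h with p x | q x | h x
    ... | true  | true  | refl = cong (x ∷_) (filterᵇ-cong xs h)
    ... | false | false | refl = filterᵇ-cong xs h

    extraBox : List ℕ → ℤ → List Box
    extraBox lb c = if ⌊ 0ℤ ℤ.≤? c ⌋ then [] else ((ℤ.∣ + suc (length lb) + c ∣ , c) ∷ [])

    hookTilde-split : ∀ lb a c → hookTilde lb a c ≡ filterᵇ (inHook lb a c) (boxes lb) ++ extraBox lb c
    hookTilde-split lb a c with ⌊ 0ℤ ℤ.≤? c ⌋ in eq
    ... | true  = trans (filterᵇ-cong {p = inHook lb a c} (boxes lb) λ (b , e) → inHook-nonneg lb a c b e eq)
                        (sym (++-identityʳ _))
    ... | false = cong (_++ _) (filterᵇ-cong {p = inHook lb a c} (boxes lb) λ (b , e) → inHook-neg lb a c b e eq)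

    tildeB-boxes : ∀ lb F x → x ∈ boxes lb → tildeB lb F x ≡ entry F x
    tildeB-boxes lb F (b , e) m with boxes-∈⁻ lb m
    ... | cell s _ _ b≤s _ refl = if-false (isYes-false (col d s ℤ.≟ (+ b - + d) - 1ℤ) left-of-row)
      where
      d = length lb
      shift : ∀ (x y : ℤ) → ((x - y) - 1ℤ) + 1ℤ ≡ x - y
      shift = solve-∀
      left-of-row : ¬ col d s ≡ (+ b - + d) - 1ℤ
      left-of-row e = ℕ.<-irrefl
        (col-injective d (trans (sym (shift (+ b) (+ d))) (trans (cong (_+ 1ℤ) (sym e)) (col-suc d s))))
        (s≤s b≤s)

    count-extraBox : ∀ (p : Box → Bool) lb c →
      count p (extraBox lb c) ≡ (if ⌊ 0ℤ ℤ.≤? c ⌋ then 0 else indicator (p (ℤ.∣ + suc (length lb) + c ∣ , c)))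
    count-extraBox p lb c with ⌊ 0ℤ ℤ.≤? c ⌋
    ... | true  = refl
    ... | false = ℕ.+-identityʳ _

  largerCount-split : ∀ lb F a c → largerCount lb F a c ≡ largerInD lb F a c ℕ.+ largerExtra lb F a c
  largerCount-split lb F a c = begin
    length (filterᵇ larger (hookTilde lb a c))
      ≡⟨ cong (λ z → length (filterᵇ larger z)) (hookTilde-split lb a c) ⟩
    length (filterᵇ larger (filterᵇ (inHook lb a c) (boxes lb) ++ extraBox lb c))
      ≡⟨ length-filterᵇ larger (filterᵇ (inHook lb a c) (boxes lb) ++ extraBox lb c) ⟩
    count larger (filterᵇ (inHook lb a c) (boxes lb) ++ extraBox lb c)
      ≡⟨ count-++ larger (filterᵇ (inHook lb a c) (boxes lb)) (extraBox lb c) ⟩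
    count larger (filterᵇ (inHook lb a c) (boxes lb)) ℕ.+ count larger (extraBox lb c)
      ≡⟨ cong₂ ℕ._+_ (trans (count-filterᵇ (inHook lb a c) larger (boxes lb))
                            (count-cong _ _ (boxes lb) λ x m →
                               cong (λ z → inHook lb a c x ∧ ⌊ F a c ℕ.<? z ⌋) (tildeB-boxes lb F x m)))
                     (count-extraBox larger lb c) ⟩
    largerInD lb F a c ℕ.+ largerExtra lb F a c ∎
    where
    open ≡-Reasoning
    larger : Box → Bool
    larger x = ⌊ F a c ℕ.<? tildeB lb F x ⌋

  largerCount-cong : ∀ lb (F G : Filling) → (∀ a e → F a e ≡ G a e) → ∀ a c → largerCount lb F a c ≡ largerCount lb G a c
  largerCount-cong lb F G F≗G a c =
    cong length (filterᵇ-cong (hookTilde lb a c) λ x → cong₂ (λ u v → ⌊ u ℕ.<? v ⌋) (F≗G a c) (tildeB≗ x))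
    where
    tildeB≗ : ∀ x → tildeB lb F x ≡ tildeB lb G x
    tildeB≗ (b , e) = cong₂ (λ u v → if ⌊ e ℤ.≟ (+ b - + length lb) - 1ℤ ⌋ then u else v) (F≗G b 0ℤ) (F≗G b e)

  largerExtra-cong : ∀ lb lb′ (F G : Filling) a c → length lb ≡ length lb′ → F a c ≡ G a c →
                     (∀ r → F r 0ℤ ≡ G r 0ℤ) → (∀ r → F r c ≡ G r c) → largerExtra lb F a c ≡ largerExtra lb′ G a c
  largerExtra-cong lb lb′ F G a c d≡d′ Fac F0 Fc =
    trans (cong (λ d → extra d (F a c) F) d≡d′)
          (cong₃ Fac (F0 (row (length lb′))) (Fc (row (length lb′))))
    where
    row : ℕ → ℕ
    row d = ℤ.∣ + suc d + c ∣
    extra : ℕ → ℕ → Filling → ℕ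
    extra d v H = if ⌊ 0ℤ ℤ.≤? c ⌋ then 0
                  else indicator ⌊ v ℕ.<? (if ⌊ c ℤ.≟ (+ row d - + d) - 1ℤ ⌋ then H (row d) 0ℤ else H (row d) c) ⌋
    cong₃ : ∀ {v v′ u u′ w w′} → v ≡ v′ → u ≡ u′ → w ≡ w′ →
            (if ⌊ 0ℤ ℤ.≤? c ⌋ then 0 else indicator ⌊ v ℕ.<?
                (if ⌊ c ℤ.≟ (+ row (length lb′) - + length lb′) - 1ℤ ⌋ then u else w) ⌋)
            ≡ (if ⌊ 0ℤ ℤ.≤? c ⌋ then 0 else indicator ⌊ v′ ℕ.<?
                (if ⌊ c ℤ.≟ (+ row (length lb′) - + length lb′) - 1ℤ ⌋ then u′ else w′) ⌋)
    cong₃ refl refl refl = refl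

  largerExtra-nonneg : ∀ lb F a c → ⌊ 0ℤ ℤ.≤? c ⌋ ≡ true → largerExtra lb F a c ≡ 0
  largerExtra-nonneg lb F a c eq rewrite eq = refl

  rk-nonneg : ∀ lb a c → ⌊ 0ℤ ℤ.≤? c ⌋ ≡ true → rk lb a c ≡ + part lb a - + length lb + + a - c
  rk-nonneg lb a c eq with ⌊ 0ℤ ℤ.≤? c ⌋
  rk-nonneg lb a c refl | true = refl

  rk-neg : ∀ lb a c → ⌊ 0ℤ ℤ.≤? c ⌋ ≡ false →
           rk lb a c ≡ + part lb a - + length lb + + a + + part lb (ℤ.∣ + suc (length lb) + c ∣) + c + 1ℤ
  rk-neg lb a c eq with ⌊ 0ℤ ℤ.≤? c ⌋
  rk-neg lb a c refl | false = refl

  largerCount-nonneg : ∀ lb F a c → ⌊ 0ℤ ℤ.≤? c ⌋ ≡ true → largerCount lb F a c ≡ largerInD lb F a c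
  largerCount-nonneg lb F a c 0≤c =
    trans (largerCount-split lb F a c) (trans (cong (largerInD lb F a c ℕ.+_) (largerExtra-nonneg lb F a c 0≤c))
        (ℕ.+-identityʳ _))

  Balanced : List ℕ → Filling → ℕ → ℤ → Set
  Balanced lb F a c = + largerCount lb F a c ≡ rk lb a c - 1ℤ

  balanced-transfer : ∀ lb F a c lb′ G a′ c′ k →
    largerCount lb F a c ≡ k ℕ.+ largerCount lb′ G a′ c′ → rk lb a c ≡ rk lb′ a′ c′ + + k →
    Balanced lb F a c ⇔ Balanced lb′ G a′ c′
  balanced-transfer lb F a c lb′ G a′ c′ k count≡ rk≡ = mk⇔ to from
    where
    X = largerCount lb′ G a′ c′
    R = rk lb′ a′ c′
    +count≡ : + largerCount lb F a c ≡ + k + + X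
    +count≡ = trans (cong (+_) count≡) (ℤ.pos-+ k X)
    to : Balanced lb F a c → Balanced lb′ G a′ c′
    to bal = trans (cancel (+ k) (+ X)) (trans (cong (_- + k) (trans (sym +count≡) (trans bal (cong (_- 1ℤ) rk≡))))
        (cancel′ (+ k) R))
      where
      cancel : ∀ (k X : ℤ) → X ≡ (k + X) - k
      cancel = solve-∀
      cancel′ : ∀ (k R : ℤ) → ((R + k) - 1ℤ) - k ≡ R - 1ℤ
      cancel′ = solve-∀
    from : Balanced lb′ G a′ c′ → Balanced lb F a c
    from bal = trans +count≡ (trans (cong (λ z → + k + z) bal) (trans (shift (+ k) R) (cong (_- 1ℤ) (sym rk≡))))
      where
      shift : ∀ (k R : ℤ) → k + (R - 1ℤ) ≡ (R + k) - 1ℤ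
      shift = solve-∀

open import Defs
open import Data.Nat using (ℕ; _≤_; _∸_)
open import Data.List using (List; length)
open import Data.Sum using (_⊎_)
open import Relation.Binary.PropositionalEquality using (_≡_)

module ColumnSwap (la : List ℕ) (st : Strict la) (i : ℕ) (1≤i : 1 ≤ i) (i≤d : i ≤ length la)
                  (gap : i ≡ 1 ⊎ part la i Data.Nat.+ 3 ≤ part la (i ∸ 1)) where

  open import Data.Bool using (Bool; true; false; if_then_else_; _∧_; _∨_)
  open import Data.Bool.Properties using (∧-zeroʳ; ∧-identityʳ; ∨-zeroʳ)
  open import Data.Nat as ℕ using (suc; s≤s; _<_)
  open import Data.Nat.Properties as ℕ using ()
  open import Data.Integer as ℤ using (ℤ; +_; _-_; _+_; 0ℤ; 1ℤ)
  open import Data.Integer.Properties as ℤ using ()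
  open import Data.Integer.Tactic.RingSolver using (solve-∀)
  open import Data.List using (_∷_; map; applyUpTo)
  open import Data.List.Properties using (map-cong-local; map-∘; applyUpTo-∷ʳ)
  open import Data.List.Membership.Propositional using (_∈_; _∉_)
  open import Data.List.Membership.Propositional.Properties using (∈-map⁺; ∈-map⁻; ∈-applyUpTo⁻)
  open import Data.List.Relation.Unary.Any using (here; there)
  import Data.List.Relation.Unary.All as All
  open import Data.List.Relation.Unary.AllPairs using (_∷_)
  import Data.List.Relation.Unary.Unique.Propositional.Properties as Unique
  open import Data.List.Relation.Binary.Permutation.Propositional as ↭ using (_↭_; ↭-sym; ↭-trans; prep)
  import Data.List.Relation.Binary.Permutation.Propositional.Properties as ↭
  open import Data.Product using (_×_; _,_; proj₁; proj₂; Σ)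
  open import Data.Sum using (inj₁; inj₂; [_,_]′)
  open import Data.Empty using (⊥-elim)
  open import Function.Bundles using (_⇔_; mk⇔; Equivalence)
  import Function.Properties.Equivalence as ⇔
  open import Relation.Nullary using (¬_; Dec; yes; no)
  open import Relation.Nullary.Decidable using (⌊_⌋; toSum)
  open import Relation.Binary.PropositionalEquality hiding (J)
  open Counting
  open Uniqueness
  open Decisions
  open Column
  open Diagram
  open StrictPartition
  open Hooks
  open Balance
  open BoundedInduction

  d N J : ℕ
  d = length la
  N = size la
  J = rowEnd la i

  la⁺ : List ℕ
  la⁺ = incAt la i

  j : ℤ
  j = col d J

  newCol≡j : newCol la i ≡ j
  newCol≡j = col-+ d (part la i) i

  j+1≡col : j + 1ℤ ≡ col d (suc J)
  j+1≡col = col-suc d J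

  d<J : d < J
  d<J = ℕ.≤-trans (ℕ.+-monoˡ-≤ d (part-positive la st d (ℕ.≤-trans 1≤i i≤d) ℕ.≤-refl))
                  (rowEnd-antitone la st 1≤i i≤d ℕ.≤-refl)

  d≤J : d ≤ J
  d≤J = ℕ.<⇒≤ d<J

  d≤J+1 : d ≤ suc J
  d≤J+1 = ℕ.m≤n⇒m≤1+n d≤J

  0≤j : ⌊ 0ℤ ℤ.≤? j ⌋ ≡ true
  0≤j = trans (isYes-0≤col d J) (isYes-true (d ℕ.≤? J) d≤J)

  0≤j+1 : ⌊ 0ℤ ℤ.≤? j + 1ℤ ⌋ ≡ true
  0≤j+1 = trans (cong (λ z → ⌊ 0ℤ ℤ.≤? z ⌋) j+1≡col) (trans (isYes-0≤col d (suc J)) (isYes-true (d ℕ.≤? suc J) d≤J+1))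

  j≢j+1 : j ≢ j + 1ℤ
  j≢j+1 e = ℕ.1+n≢n (sym (col-injective d (trans e j+1≡col)))

  0≢j : 0ℤ ≢ j
  0≢j e = ℕ.<-irrefl (col-injective d (trans (col-self d) e)) d<J

  0≢j+1 : 0ℤ ≢ j + 1ℤ
  0≢j+1 e = ℕ.<-irrefl (col-injective d (trans (col-self d) (trans e j+1≡col))) (ℕ.m≤n⇒m≤1+n d<J)

  reaches-J⇒above : ∀ {b s} → b ≤ d → s < b ℕ.+ part la b → J ≤ s → b < i
  reaches-J⇒above {b} b≤d s<end J≤s with b ℕ.<? i
  ... | yes b<i = b<i
  ... | no  b≮i = ⊥-elim (ℕ.<-irrefl refl (ℕ.<-≤-trans s<end
        (ℕ.≤-trans (ℕ.≤-reflexive (ℕ.+-comm b (part la b))) (ℕ.≤-trans (rowEnd-antitone la st 1≤i (ℕ.≮⇒≥ b≮i) b≤d) J≤s))))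

  above⇒reaches-J+1 : ∀ {a} → 1 ≤ a → a < i → suc (suc J) ≤ a ℕ.+ part la a
  above⇒reaches-J+1 {a} 1≤a a<i =
    ℕ.≤-trans (rowEnd-gap la st i i≤d gap a 1≤a a<i) (ℕ.≤-reflexive (ℕ.+-comm (part la a) a))

  in-row-i⇒before-J : ∀ {t} → (i , col d t) ∈ boxes la → t < J
  in-row-i⇒before-J m with boxes-∈⁻ la m
  ... | cell s _ _ _ s<end e = subst (_< J) (col-injective d (sym e))
      (ℕ.<-≤-trans s<end (ℕ.≤-reflexive (ℕ.+-comm i (part la i))))

  in-col⇒above : ∀ {b t} → (b , col d t) ∈ boxes la → J ≤ t → b < i
  in-col⇒above m J≤t with boxes-∈⁻ la m
  ... | cell s _ b≤d _ s<end e = reaches-J⇒above b≤d s<end (subst (J ≤_) (col-injective d e) J≤t)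

  new∉boxes : (i , j) ∉ boxes la
  new∉boxes m = ℕ.<-irrefl refl (in-row-i⇒before-J m)

  col-j-∈ : ∀ {a} → 1 ≤ a → a < i → (a , j) ∈ boxes la
  col-j-∈ 1≤a a<i = boxes-∈⁺ la (cell J 1≤a a≤d (ℕ.≤-trans a≤d d≤J)
    (ℕ.≤-trans (ℕ.n≤1+n (suc J)) (above⇒reaches-J+1 1≤a a<i)) refl)
    where a≤d = ℕ.≤-trans (ℕ.<⇒≤ a<i) i≤d

  col-j+1-∈ : ∀ {a} → 1 ≤ a → a < i → (a , j + 1ℤ) ∈ boxes la
  col-j+1-∈ {a} 1≤a a<i = subst (λ z → (a , z) ∈ boxes la) (sym j+1≡col)
    (boxes-∈⁺ la (cell (suc J) 1≤a a≤d (ℕ.≤-trans a≤d d≤J+1) (above⇒reaches-J+1 1≤a a<i) refl))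
    where a≤d = ℕ.≤-trans (ℕ.<⇒≤ a<i) i≤d

  swapCol : ℤ → ℤ
  swapCol e = if ⌊ e ℤ.≟ j ⌋ then j + 1ℤ else if ⌊ e ℤ.≟ j + 1ℤ ⌋ then j else e

  swapBox : Box → Box
  swapBox (b , e) = (b , swapCol e)

  swapCol-j : swapCol j ≡ j + 1ℤ
  swapCol-j = if-true (isYes-true (j ℤ.≟ j) refl)

  swapCol-j+1 : swapCol (j + 1ℤ) ≡ j
  swapCol-j+1 = trans (if-false (isYes-false (j + 1ℤ ℤ.≟ j) (≢-sym j≢j+1)))
                      (if-true (isYes-true (j + 1ℤ ℤ.≟ j + 1ℤ) refl))

  swapCol-other : ∀ {e} → e ≢ j → e ≢ j + 1ℤ → swapCol e ≡ e
  swapCol-other {e} e≢j e≢j+1 = trans (if-false (isYes-false (e ℤ.≟ j) e≢j)) (if-false (isYes-false (e ℤ.≟ j + 1ℤ) e≢j+1))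

  swapCol-involutive : ∀ e → swapCol (swapCol e) ≡ e
  swapCol-involutive e with toSum (e ℤ.≟ j) | toSum (e ℤ.≟ j + 1ℤ)
  ... | inj₁ refl | _         = trans (cong swapCol swapCol-j) swapCol-j+1
  ... | inj₂ _    | inj₁ refl = trans (cong swapCol swapCol-j+1) swapCol-j
  ... | inj₂ e≢j  | inj₂ e≢j+1 = trans (cong swapCol (swapCol-other e≢j e≢j+1)) (swapCol-other e≢j e≢j+1)

  swapBox-involutive : ∀ x → swapBox (swapBox x) ≡ x
  swapBox-involutive (b , e) = cong (b ,_) (swapCol-involutive e)

  swapBox-injective : ∀ {x y} → swapBox x ≡ swapBox y → x ≡ y
  swapBox-injective {x} {y} e = trans (sym (swapBox-involutive x)) (trans (cong swapBox e) (swapBox-involutive y))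

  data ShiftView (t : ℕ) : Set where
    at-J      : t ≡ J → ShiftView t
    at-J+1    : t ≡ suc J → ShiftView t
    elsewhere : t ≢ J → t ≢ suc J → ShiftView t

  shiftView : ∀ t → ShiftView t
  shiftView t with t ℕ.≟ J | t ℕ.≟ suc J
  ... | yes t≡J | _          = at-J t≡J
  ... | no  _   | yes t≡J+1  = at-J+1 t≡J+1
  ... | no t≢J  | no t≢J+1   = elsewhere t≢J t≢J+1

  swapShift : ℕ → ℕ
  swapShift t = if ⌊ t ℕ.≟ J ⌋ then suc J else if ⌊ t ℕ.≟ suc J ⌋ then J else t

  swapCol-col : ∀ t → swapCol (col d t) ≡ col d (swapShift t)
  swapCol-col t with shiftView t
  ... | at-J refl = trans swapCol-j (trans j+1≡col (cong (col d) (sym (if-true (isYes-true (J ℕ.≟ J) refl)))))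
  ... | at-J+1 refl = trans (cong swapCol (sym j+1≡col)) (trans swapCol-j+1 (cong (col d) (sym
        (trans (if-false (isYes-false (suc J ℕ.≟ J) ℕ.1+n≢n)) (if-true (isYes-true (suc J ℕ.≟ suc J) refl))))))
  ... | elsewhere t≢J t≢J+1 =
        trans (swapCol-other (λ e → t≢J (col-injective d e)) (λ e → t≢J+1 (col-injective d (trans e j+1≡col))))
              (cong (col d) (sym (trans (if-false (isYes-false (t ℕ.≟ J) t≢J))
                  (if-false (isYes-false (t ℕ.≟ suc J) t≢J+1)))))

  swapBox-∈ : ∀ {x} → x ∈ boxes la → swapBox x ∈ boxes la
  swapBox-∈ {b , e} m with boxes-∈⁻ la m
  ... | cell s 1≤b b≤d b≤s s<end refl with shiftView s
  ... | at-J refl = subst (λ z → (b , z) ∈ boxes la) (trans (sym j+1≡col) (sym swapCol-j))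
        (boxes-∈⁺ la (cell (suc J) 1≤b b≤d (ℕ.m≤n⇒m≤1+n b≤s) (above⇒reaches-J+1 1≤b b<i) refl))
    where b<i = reaches-J⇒above b≤d s<end ℕ.≤-refl
  ... | at-J+1 refl = subst (λ z → (b , z) ∈ boxes la) (trans (sym swapCol-j+1) (cong swapCol j+1≡col))
        (boxes-∈⁺ la (cell J 1≤b b≤d (ℕ.≤-trans b≤d d≤J) (ℕ.<-trans (ℕ.n<1+n J) s<end) refl))
  ... | elsewhere s≢J s≢J+1 = subst (λ z → (b , z) ∈ boxes la) (sym (trans (swapCol-col s)
        (cong (col d) (trans (if-false (isYes-false (s ℕ.≟ J) s≢J)) (if-false (isYes-false (s ℕ.≟ suc J) s≢J+1)))))) m

  swapBox-↭ : map swapBox (boxes la) ↭ boxes la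
  swapBox-↭ = unique-same-elements⇒↭ (Unique.map⁺ swapBox-injective (boxes-unique la)) (boxes-unique la) to from
    where
    to : ∀ {x} → x ∈ map swapBox (boxes la) → x ∈ boxes la
    to m with ∈-map⁻ swapBox m
    ... | _ , m′ , refl = swapBox-∈ m′
    from : ∀ {x} → x ∈ boxes la → x ∈ map swapBox (boxes la)
    from {x} m = subst (_∈ map swapBox (boxes la)) (swapBox-involutive x) (∈-map⁺ swapBox (swapBox-∈ m))

  length-la⁺ : length la⁺ ≡ d
  length-la⁺ = length-incAt la i

  part⁺ : ∀ b → part la⁺ b ≡ part la b ℕ.+ indicator ⌊ b ℕ.≟ i ⌋
  part⁺ b with toSum (b ℕ.≟ i)
  ... | inj₁ refl = trans (part-incAt-≡ la i 1≤i i≤d)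
                          (trans (ℕ.+-comm 1 (part la i))
                              (cong (λ z → part la i ℕ.+ indicator z) (sym (isYes-true (i ℕ.≟ i) refl))))
  ... | inj₂ b≢i = trans (part-incAt-≢ la i b b≢i)
                         (trans (sym (ℕ.+-identityʳ _))
                             (cong (λ z → part la b ℕ.+ indicator z) (sym (isYes-false (b ℕ.≟ i) b≢i))))

  boxes⁺-∈⁻ : ∀ {b e} → (b , e) ∈ boxes la⁺ → (b , e) ≡ (i , j) ⊎ (b , e) ∈ boxes la
  boxes⁺-∈⁻ {b} {e} m with boxes-∈⁻ la⁺ m
  ... | cell s 1≤b b≤d b≤s s<end refl rewrite length-la⁺ with b ℕ.≟ i
  ... | no b≢i = inj₂ (boxes-∈⁺ la (cell s 1≤b b≤d b≤s (subst (λ z → s < b ℕ.+ z) (part-incAt-≢ la i b b≢i) s<end) refl))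
  ... | yes refl with s ℕ.≟ i ℕ.+ part la i
  ... | yes refl = inj₁ (cong (i ,_) (cong (col d) (ℕ.+-comm i (part la i))))
  ... | no s≢J = inj₂ (boxes-∈⁺ la (cell s 1≤b b≤d b≤s (ℕ.≤∧≢⇒< (ℕ.≤-pred s<end′) s≢J) refl))
    where
    s<end′ : s < suc (i ℕ.+ part la i)
    s<end′ = subst (s <_) (trans (cong (i ℕ.+_) (part-incAt-≡ la i 1≤i i≤d)) (ℕ.+-suc i (part la i))) s<end

  boxes⁺-∈⁺ : ∀ {x} → x ≡ (i , j) ⊎ x ∈ boxes la → x ∈ boxes la⁺
  boxes⁺-∈⁺ (inj₁ refl) = boxes-∈⁺ la⁺ (cell J 1≤i (subst (i ≤_) (sym length-la⁺) i≤d) (ℕ.m≤n+m i (part la i))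
    (subst (J <_) (sym (cong (i ℕ.+_) (part-incAt-≡ la i 1≤i i≤d)))
           (subst (_< i ℕ.+ suc (part la i)) (ℕ.+-comm i (part la i))
               (subst (i ℕ.+ part la i <_) (sym (ℕ.+-suc i (part la i))) (ℕ.n<1+n _))))
    (cong (λ z → col z J) (sym length-la⁺)))
  boxes⁺-∈⁺ (inj₂ m) with boxes-∈⁻ la m
  ... | cell s 1≤b b≤d b≤s s<end refl = boxes-∈⁺ la⁺ (cell s 1≤b (subst (_ ≤_) (sym length-la⁺) b≤d) b≤s
          (ℕ.<-≤-trans s<end (ℕ.+-monoʳ-≤ _ (subst (part la _ ≤_) (sym (part⁺ _)) (ℕ.m≤m+n _ _))))
          (cong (λ z → col z s) (sym length-la⁺)))

  boxes⁺-↭ : boxes la⁺ ↭ (i , j) ∷ boxes la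
  boxes⁺-↭ = unique-same-elements⇒↭ (boxes-unique la⁺)
      (All.tabulate (λ m e → new∉boxes (subst (_∈ boxes la) (sym e) m)) ∷ boxes-unique la)
    (λ m → [ here , there ]′ (boxes⁺-∈⁻ m))
    (λ { (here e) → boxes⁺-∈⁺ (inj₁ e) ; (there m) → boxes⁺-∈⁺ (inj₂ m) })

  sharp-unfold : ∀ B a e → sharp la i B a e ≡ (if ⌊ a ℕ.≟ i ⌋ ∧ ⌊ e ℤ.≟ j ⌋ then suc N else B a (swapCol e))
  sharp-unfold B a e = trans (subst (λ j′ → sharp la i B a e ≡ nested j′) newCol≡j refl) flatten
    where
    nested : ℤ → ℕ
    nested j′ = if ⌊ a ℕ.≟ i ⌋ ∧ ⌊ e ℤ.≟ j′ ⌋ then suc N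
                else if ⌊ e ℤ.≟ j′ ⌋ then B a (j′ + 1ℤ)
                else if ⌊ e ℤ.≟ j′ + 1ℤ ⌋ then B a j′ else B a e
    flatten : nested j ≡ (if ⌊ a ℕ.≟ i ⌋ ∧ ⌊ e ℤ.≟ j ⌋ then suc N else B a (swapCol e))
    flatten with ⌊ a ℕ.≟ i ⌋ ∧ ⌊ e ℤ.≟ j ⌋
    ... | true = refl
    ... | false with ⌊ e ℤ.≟ j ⌋
    ...   | true = refl
    ...   | false with ⌊ e ℤ.≟ j + 1ℤ ⌋
    ...     | true  = refl
    ...     | false = refl

  sharp-new : ∀ B → sharp la i B i j ≡ suc N
  sharp-new B = trans (sharp-unfold B i j) (if-true (cong₂ _∧_ (isYes-true (i ℕ.≟ i) refl) (isYes-true (j ℤ.≟ j) refl)))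

  sharp-swapped : ∀ B a e → ¬ (a ≡ i × e ≡ j) → sharp la i B a e ≡ B a (swapCol e)
  sharp-swapped B a e ¬new = trans (sharp-unfold B a e) (if-false (∧-false (a ℕ.≟ i) (e ℤ.≟ j)))
    where
    ∧-false : (p : Dec (a ≡ i)) (q : Dec (e ≡ j)) → (⌊ p ⌋ ∧ ⌊ q ⌋) ≡ false
    ∧-false (yes a≡i) (yes e≡j) = ⊥-elim (¬new (a≡i , e≡j))
    ∧-false (yes _)   (no _)    = refl
    ∧-false (no _)    _         = refl

  sharp-outside : ∀ B a e → e ≢ j → e ≢ j + 1ℤ → sharp la i B a e ≡ B a e
  sharp-outside B a e e≢j e≢j+1 = trans (sharp-swapped B a e (λ p → e≢j (proj₂ p))) (cong (B a) (swapCol-other e≢j e≢j+1))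

  sharp-j : ∀ B a → a < i → sharp la i B a j ≡ B a (j + 1ℤ)
  sharp-j B a a<i = trans (sharp-swapped B a j (λ p → ℕ.<-irrefl (proj₁ p) a<i)) (cong (B a) swapCol-j)

  sharp-j+1 : ∀ B a → a < i → sharp la i B a (j + 1ℤ) ≡ B a j
  sharp-j+1 B a a<i = trans (sharp-swapped B a (j + 1ℤ) (λ p → ℕ.<-irrefl (proj₁ p) a<i)) (cong (B a) swapCol-j+1)

  sharp-old : ∀ B {x} → x ∈ boxes la → entry (sharp la i B) x ≡ entry B (swapBox x)
  sharp-old B {b , e} m = sharp-swapped B b e (λ { (refl , refl) → new∉boxes m })

  sharp-swapBox : ∀ B {x} → x ∈ boxes la → entry (sharp la i B) (swapBox x) ≡ entry B x
  sharp-swapBox B {x} m = trans (sharp-old B (swapBox-∈ m)) (cong (entry B) (swapBox-involutive x))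

  sharp-entries-↭ : ∀ B → map (entry (sharp la i B)) (boxes la⁺) ↭ suc N ∷ map (entry B) (boxes la)
  sharp-entries-↭ B = ↭-trans (↭.map⁺ (entry (sharp la i B)) boxes⁺-↭)
    (subst (λ z → z ∷ map (entry (sharp la i B)) (boxes la) ↭ suc N ∷ map (entry B) (boxes la)) (sym (sharp-new B))
      (prep (suc N) (subst (_↭ map (entry B) (boxes la)) (sym old-entries) (↭.map⁺ (entry B) swapBox-↭))))
    where
    old-entries : map (entry (sharp la i B)) (boxes la) ≡ map (entry B) (map swapBox (boxes la))
    old-entries = trans (map-cong-local (All.tabulate (sharp-old B))) (map-∘ (boxes la))

  AllBalanced : List ℕ → Filling → Set
  AllBalanced lb F = ∀ a c → (a , c) ∈ boxes lb → Balanced lb F a c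

  count-swapBox : ∀ (q : Box → Bool) → count q (boxes la) ≡ count (λ x → q (swapBox x)) (boxes la)
  count-swapBox q = trans (count-↭ q (↭-sym swapBox-↭)) (count-map q swapBox (boxes la))

  largerInD⁺ : ∀ F a c →
    largerInD la⁺ F a c ≡ indicator (inHook la a c (i , j) ∧ ⌊ F a c ℕ.<? F i j ⌋) ℕ.+ largerInD la F a c
  largerInD⁺ F a c = trans (count-cong _ _ (boxes la⁺) λ x _ → cong (_∧ ⌊ F a c ℕ.<? entry F x ⌋)
      (inHook-length la⁺ la length-la⁺ a c x))
                           (count-↭ _ boxes⁺-↭)

  largerInD-sharp : ∀ B a c v →
    count (λ x → inHook la a c x ∧ ⌊ v ℕ.<? entry (sharp la i B) x ⌋) (boxes la)
    ≡ count (λ x → inHook la a c (swapBox x) ∧ ⌊ v ℕ.<? entry B x ⌋) (boxes la)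
  largerInD-sharp B a c v = trans (count-swapBox _)
    (count-cong _ _ (boxes la) λ x m → cong (λ z → inHook la a c (swapBox x) ∧ ⌊ v ℕ.<? z ⌋) (sharp-swapBox B m))

  inHook-j : ∀ a b t → inHook la a j (b , col d t) ≡ inHookℕ d a J b t
  inHook-j a b t = inHook-col la a J b t

  inHook-j+1 : ∀ a b t → inHook la a (j + 1ℤ) (b , col d t) ≡ inHookℕ d a (suc J) b t
  inHook-j+1 a b t = trans (cong (λ z → inHook la a z (b , col d t)) j+1≡col) (inHook-col la a (suc J) b t)

  inHook-j-swapped : ∀ a b t → inHook la a j (swapBox (b , col d t)) ≡ inHookℕ d a J b (swapShift t)
  inHook-j-swapped a b t = trans (cong (λ z → inHook la a j (b , z)) (swapCol-col t)) (inHook-j a b (swapShift t))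

  inHook-j+1-swapped : ∀ a b t → inHook la a (j + 1ℤ) (swapBox (b , col d t)) ≡ inHookℕ d a (suc J) b (swapShift t)
  inHook-j+1-swapped a b t = trans (cong (λ z → inHook la a (j + 1ℤ) (b , z)) (swapCol-col t))
      (inHook-j+1 a b (swapShift t))

  entry-swapped : ∀ B b t → entry B (swapBox (b , col d t)) ≡ B b (col d (swapShift t))
  entry-swapped B b t = cong (B b) (swapCol-col t)

  swapShift-J : swapShift J ≡ suc J
  swapShift-J = if-true (isYes-true (J ℕ.≟ J) refl)

  swapShift-J+1 : swapShift (suc J) ≡ J
  swapShift-J+1 = trans (if-false (isYes-false (suc J ℕ.≟ J) ℕ.1+n≢n)) (if-true (isYes-true (suc J ℕ.≟ suc J) refl))

  swapShift-other : ∀ {t} → t ≢ J → t ≢ suc J → swapShift t ≡ t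
  swapShift-other {t} t≢J t≢J+1 = trans (if-false (isYes-false (t ℕ.≟ J) t≢J)) (if-false (isYes-false (t ℕ.≟ suc J) t≢J+1))

  hookJ-off : ∀ a b t → t ≢ J → t ≢ suc J → inHookℕ d a J b t ≡ inArm a (suc J) b t
  hookJ-off a b t t≢J t≢J+1 = trans (inHookℕ-off-col d≤J a b t t≢J) (inArm-suc a J b t t≢J)

  -- The count of H(a, c) in B^#, read back in B; B(a, c′) is the entry that B^# has at (a, c).
  swappedLarger : ℤ → ℤ → Filling → ℕ → ℕ
  swappedLarger c c′ B a = count (λ x → inHook la a c (swapBox x) ∧ ⌊ B a c′ ℕ.<? entry B x ⌋) (boxes la)

  largerCount-sharp-j : ∀ B a → a < i → B a (j + 1ℤ) ≤ N →
                        largerCount la⁺ (sharp la i B) a j ≡ suc (swappedLarger j (j + 1ℤ) B a)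
  largerCount-sharp-j B a a<i bound = begin
    largerCount la⁺ T a j
      ≡⟨ largerCount-nonneg la⁺ T a j 0≤j ⟩
    largerInD la⁺ T a j
      ≡⟨ largerInD⁺ T a j ⟩
    indicator (inHook la a j (i , j) ∧ ⌊ T a j ℕ.<? T i j ⌋) ℕ.+ largerInD la T a j
      ≡⟨ cong₂ ℕ._+_ (cong indicator (cong₂ _∧_ new-in-hook new-larger)) (largerInD-sharp B a j (T a j)) ⟩
    suc (count (λ x → inHook la a j (swapBox x) ∧ ⌊ T a j ℕ.<? entry B x ⌋) (boxes la))
      ≡⟨ cong (λ v → suc (count (λ x → inHook la a j (swapBox x) ∧ ⌊ v ℕ.<? entry B x ⌋) (boxes la))) (sharp-j B a a<i) ⟩
    suc (swappedLarger j (j + 1ℤ) B a) ∎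
    where
    open ≡-Reasoning
    T = sharp la i B
    new-in-hook : inHook la a j (i , j) ≡ true
    new-in-hook = trans (inHook-j a i J) (trans (inHookℕ-same-col d≤J a i)
                    (trans (cong (⌊ i ℕ.≟ a ⌋ ∨_) (isYes-true (a ℕ.<? i) a<i)) (∨-zeroʳ _)))
    new-larger : ⌊ T a j ℕ.<? T i j ⌋ ≡ true
    new-larger = isYes-true (T a j ℕ.<? T i j) (subst₂ _<_ (sym (sharp-j B a a<i)) (sym (sharp-new B)) (s≤s bound))

  largerCount-sharp-j+1 : ∀ B a → a < i → largerCount la⁺ (sharp la i B) a (j + 1ℤ) ≡ swappedLarger (j + 1ℤ) j B a
  largerCount-sharp-j+1 B a a<i = begin
    largerCount la⁺ T a (j + 1ℤ)
      ≡⟨ largerCount-nonneg la⁺ T a (j + 1ℤ) 0≤j+1 ⟩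
    largerInD la⁺ T a (j + 1ℤ)
      ≡⟨ largerInD⁺ T a (j + 1ℤ) ⟩
    indicator (inHook la a (j + 1ℤ) (i , j) ∧ ⌊ T a (j + 1ℤ) ℕ.<? T i j ⌋) ℕ.+ largerInD la T a (j + 1ℤ)
      ≡⟨ cong₂ ℕ._+_ (cong (λ z → indicator (z ∧ ⌊ T a (j + 1ℤ) ℕ.<? T i j ⌋)) new-not-in-hook)
          (largerInD-sharp B a (j + 1ℤ) (T a (j + 1ℤ))) ⟩
    count (λ x → inHook la a (j + 1ℤ) (swapBox x) ∧ ⌊ T a (j + 1ℤ) ℕ.<? entry B x ⌋) (boxes la)
      ≡⟨ cong (λ v → count (λ x → inHook la a (j + 1ℤ) (swapBox x) ∧ ⌊ v ℕ.<? entry B x ⌋) (boxes la))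
          (sharp-j+1 B a a<i) ⟩
    swappedLarger (j + 1ℤ) j B a ∎
    where
    open ≡-Reasoning
    T = sharp la i B
    new-not-in-hook : inHook la a (j + 1ℤ) (i , j) ≡ false
    new-not-in-hook = trans (inHook-j+1 a i J) (inHookℕ-prev-col d≤J a i)

  rk-j : ∀ lb a → rk lb a j ≡ rk lb a (j + 1ℤ) + 1ℤ
  rk-j lb a = trans (rk-nonneg lb a j 0≤j) (trans (shift (+ part lb a - + length lb + + a) j)
                    (cong (_+ 1ℤ) (sym (rk-nonneg lb a (j + 1ℤ) 0≤j+1))))
    where
    shift : ∀ (R c : ℤ) → R - c ≡ (R - (c + 1ℤ)) + 1ℤ
    shift = solve-∀

  rk⁺-other-row : ∀ a c → a ≢ i → ⌊ 0ℤ ℤ.≤? c ⌋ ≡ true → rk la⁺ a c ≡ rk la a c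
  rk⁺-other-row a c a≢i 0≤c = trans (rk-nonneg la⁺ a c 0≤c)
    (trans (cong₂ (λ u v → + u - + v + + a - c) (part-incAt-≢ la i a a≢i) length-la⁺) (sym (rk-nonneg la a c 0≤c)))

  balanced-new : ∀ B → Balanced la⁺ (sharp la i B) i j
  balanced-new B = trans (cong (+_) no-larger) (sym (cong (_- 1ℤ) rk-new))
    where
    T = sharp la i B
    hook-empty : ∀ {x} → x ∈ boxes la → inHook la i j x ≡ false
    hook-empty {b , e} m with boxes-∈⁻ la m
    ... | cell t _ _ _ _ refl = trans (inHook-j i b t) (trans (inHookℕ-nonneg d≤J i b t) (cong₂ _∨_ arm leg))
      where
      arm : inArm i J b t ≡ false
      arm with toSum (b ℕ.≟ i)
      ... | inj₁ refl = trans (cong (_∧ ⌊ J ℕ.≤? t ⌋) (isYes-true (b ℕ.≟ b) refl))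
                              (isYes-false (J ℕ.≤? t) (ℕ.<⇒≱ (in-row-i⇒before-J m)))
      ... | inj₂ b≢i  = cong (_∧ ⌊ J ℕ.≤? t ⌋) (isYes-false (b ℕ.≟ i) b≢i)
      leg : inLeg i J b t ≡ false
      leg with toSum (t ℕ.≟ J)
      ... | inj₁ refl = trans (cong (⌊ t ℕ.≟ J ⌋ ∧_)
          (isYes-false (i ℕ.<? b) (λ i<b → ℕ.<-asym i<b (in-col⇒above m ℕ.≤-refl))))
                              (∧-zeroʳ _)
      ... | inj₂ t≢J  = cong (_∧ ⌊ i ℕ.<? b ⌋) (isYes-false (t ℕ.≟ J) t≢J)
    no-larger : largerCount la⁺ T i j ≡ 0
    no-larger = trans (largerCount-nonneg la⁺ T i j 0≤j) (trans (largerInD⁺ T i j)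
      (cong₂ ℕ._+_ (cong indicator (trans (cong (inHook la i j (i , j) ∧_)
          (isYes-false (T i j ℕ.<? T i j) (ℕ.<-irrefl refl))) (∧-zeroʳ _)))
                   (count-false _ (boxes la) λ x m → cong (_∧ ⌊ T i j ℕ.<? entry T x ⌋) (hook-empty m))))
    rk-new : rk la⁺ i j ≡ 1ℤ
    rk-new = trans (rk-nonneg la⁺ i j 0≤j)
      (trans (cong₂ (λ u v → + u - + v + + i - j) (part-incAt-≡ la i 1≤i i≤d) length-la⁺) (arith (part la i) i d))
      where
      arith : ∀ l i d → + suc l - + d + + i - col d (l ℕ.+ i) ≡ 1ℤ
      arith l i d rewrite ℤ.pos-+ l i = ring (+ l) (+ i) (+ d)
        where
        ring : ∀ (l i d : ℤ) → ((1ℤ + l) - d + i) - ((l + i) - d) ≡ 1ℤ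
        ring = solve-∀

  Ascending : Filling → ℕ → Set
  Ascending B a = B a j < B a (j + 1ℤ)

  private
    counts-from-ranks : ∀ x y (R : ℤ) → + x ≡ (R + 1ℤ) - 1ℤ → + y ≡ R - 1ℤ → x ≡ suc y
    counts-from-ranks x y R x≡ y≡ = ℤ.+-injective (begin
      + x                ≡⟨ x≡ ⟩
      (R + 1ℤ) - 1ℤ      ≡⟨ ring R ⟩
      (R - 1ℤ) + 1ℤ      ≡⟨ cong (_+ 1ℤ) (sym y≡) ⟩
      + y + 1ℤ           ≡⟨ sym (ℤ.pos-+ y 1) ⟩
      + (y ℕ.+ 1)        ≡⟨ cong (+_) (ℕ.+-comm y 1) ⟩
      + suc y            ∎)
      where
      open ≡-Reasoning
      ring : ∀ (R : ℤ) → (R + 1ℤ) - 1ℤ ≡ (R - 1ℤ) + 1ℤ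
      ring = solve-∀

  larger-j⇒larger-j+1 : ∀ B a → a < i → (∀ b → a < b → b < i → Ascending B b) → B a (j + 1ℤ) ≤ B a j →
    ∀ x → x ∈ boxes la → (inHook la a j x ∧ ⌊ B a j ℕ.<? entry B x ⌋) ≡ true →
    (inHook la a (j + 1ℤ) (swapBox x) ∧ ⌊ B a (j + 1ℤ) ℕ.<? entry B (swapBox x) ⌋) ≡ true
  larger-j⇒larger-j+1 B a a<i asc-below descent (b , e) m larger with boxes-∈⁻ la m
  ... | cell t _ _ _ _ refl with ∧-true _ _ larger
  ... | in-hook , bigger with shiftView t
  ... | at-J refl with ∨-true _ _ (trans (sym (inHookℕ-same-col d≤J a b)) (trans (sym (inHook-j a b J)) in-hook))
  ...   | inj₁ b≡a with isYes-witness (b ℕ.≟ a) b≡a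
  ...     | refl = ⊥-elim (ℕ.<-irrefl refl (isYes-witness (B a j ℕ.<? B a j) bigger))
  larger-j⇒larger-j+1 B a a<i asc-below descent (b , e) m larger
    | cell t _ _ _ _ refl | in-hook , bigger | at-J refl | inj₂ a<b =
    cong₂ _∧_
      (trans (inHook-j+1-swapped a b J) (trans (cong (inHookℕ d a (suc J) b) swapShift-J)
        (trans (inHookℕ-same-col d≤J+1 a b) (trans (cong (⌊ b ℕ.≟ a ⌋ ∨_) a<b) (∨-zeroʳ _)))))
      (isYes-true (B a (j + 1ℤ) ℕ.<? entry B (swapBox (b , j)))
        (subst (B a (j + 1ℤ) <_) (sym (trans (entry-swapped B b J)
            (cong (B b) (trans (cong (col d) swapShift-J) (sym j+1≡col)))))
          (ℕ.≤-<-trans descent (ℕ.<-trans (isYes-witness (B a j ℕ.<? B b j) bigger)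
                                          (asc-below b (isYes-witness (a ℕ.<? b) a<b) (in-col⇒above m ℕ.≤-refl))))))
  larger-j⇒larger-j+1 B a a<i asc-below descent (b , e) m larger
    | cell t _ _ _ _ refl | in-hook , bigger | at-J+1 refl
    with isYes-witness (b ℕ.≟ a) (trans (sym (inHookℕ-next-col d≤J a b)) (trans (sym (inHook-j a b (suc J))) in-hook))
  ... | refl = ⊥-elim (ℕ.<-irrefl refl (ℕ.<-≤-trans (isYes-witness (B a j ℕ.<? B a (col d (suc J))) bigger)
                                                   (subst (_≤ B a j) (cong (B a) j+1≡col) descent)))
  larger-j⇒larger-j+1 B a a<i asc-below descent (b , e) m larger
    | cell t _ _ _ _ refl | in-hook , bigger | elsewhere t≢J t≢J+1 =
    cong₂ _∧_
      (trans (inHook-j+1-swapped a b t) (trans (cong (inHookℕ d a (suc J) b) (swapShift-other t≢J t≢J+1))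
        (trans (inHookℕ-off-col d≤J+1 a b t t≢J+1)
            (trans (sym (hookJ-off a b t t≢J t≢J+1)) (trans (sym (inHook-j a b t)) in-hook)))))
      (isYes-true (B a (j + 1ℤ) ℕ.<? entry B (swapBox (b , col d t)))
        (subst (B a (j + 1ℤ) <_) (sym (trans (entry-swapped B b t)
            (cong (λ z → B b (col d z)) (swapShift-other t≢J t≢J+1))))
          (ℕ.≤-<-trans descent (isYes-witness (B a j ℕ.<? B b (col d t)) bigger))))

  balanced⇒ascending : ∀ B → AllBalanced la B → ∀ a → 1 ≤ a → a < i → Ascending B a
  balanced⇒ascending B bal = downward-induction i step
    where
    step : ∀ a → 1 ≤ a → a < i → (∀ b → a < b → b < i → Ascending B b) → Ascending B a
    step a 1≤a a<i asc-below with B a j ℕ.<? B a (j + 1ℤ)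
    ... | yes asc = asc
    ... | no ¬asc = ⊥-elim (ℕ.<-irrefl refl (subst (_≤ count-j+1) count-j≡ count-j≤))
      where
      count-j = largerInD la B a j
      count-j+1 = largerInD la B a (j + 1ℤ)
      count-j≤ : count-j ≤ count-j+1
      count-j≤ = ℕ.≤-trans (count-mono _ _ (boxes la) (larger-j⇒larger-j+1 B a a<i asc-below (ℕ.≮⇒≥ ¬asc)))
                           (ℕ.≤-reflexive (sym (count-swapBox _)))
      count-j≡ : count-j ≡ suc count-j+1
      count-j≡ = counts-from-ranks count-j count-j+1 (rk la a (j + 1ℤ))
        (trans (cong (+_) (sym (largerCount-nonneg la B a j 0≤j)))
               (trans (bal a j (col-j-∈ 1≤a a<i)) (cong (_- 1ℤ) (rk-j la a))))
        (trans (cong (+_) (sym (largerCount-nonneg la B a (j + 1ℤ) 0≤j+1))) (bal a (j + 1ℤ) (col-j+1-∈ 1≤a a<i)))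

  larger-j+1⇒larger-j : ∀ B a → a < i → (∀ b → a < b → b < i → Ascending B b) → B a (j + 1ℤ) < B a j →
    ∀ x → x ∈ boxes la → (inHook la a (j + 1ℤ) (swapBox (swapBox x)) ∧ ⌊ B a j ℕ.<? entry B (swapBox x) ⌋) ≡ true →
    (inHook la a j (swapBox x) ∧ ⌊ B a (j + 1ℤ) ℕ.<? entry B x ⌋) ≡ true
  larger-j+1⇒larger-j B a a<i asc-below descent (b , e) m larger with boxes-∈⁻ la m
  ... | cell t _ _ _ _ refl with ∧-true _ _ larger
  ... | in-hook , bigger = go (shiftView t)
         (trans (sym (inHook-j+1 a b t)) (trans (cong (inHook la a (j + 1ℤ)) (sym (swapBox-involutive (b , col d t))))
             in-hook))
         (isYes-witness (B a j ℕ.<? B b (col d (swapShift t)))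
             (trans (cong (λ z → ⌊ B a j ℕ.<? z ⌋) (sym (entry-swapped B b t))) bigger))
    where
    go : ShiftView t → inHookℕ d a (suc J) b t ≡ true → B a j < B b (col d (swapShift t)) →
         (inHook la a j (swapBox (b , col d t)) ∧ ⌊ B a (j + 1ℤ) ℕ.<? B b (col d t) ⌋) ≡ true
    go (at-J refl) hook _ with trans (sym (inHookℕ-prev-col d≤J a b)) hook
    ... | ()
    go (at-J+1 refl) hook big with ∨-true _ _ (trans (sym (inHookℕ-same-col d≤J+1 a b)) hook)
    ... | inj₁ b≡a with isYes-witness (b ℕ.≟ a) b≡a
    ...   | refl = ⊥-elim (ℕ.<-irrefl refl (subst (B a j <_) (cong (λ z → B a (col d z)) swapShift-J+1) big))
    go (at-J+1 refl) hook big | inj₂ a<b =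
      cong₂ _∧_
        (trans (inHook-j-swapped a b (suc J)) (trans (cong (inHookℕ d a J b) swapShift-J+1)
          (trans (inHookℕ-same-col d≤J a b) (trans (cong (⌊ b ℕ.≟ a ⌋ ∨_) a<b) (∨-zeroʳ _)))))
        (isYes-true (B a (j + 1ℤ) ℕ.<? B b (col d (suc J))) (subst (B a (j + 1ℤ) <_) (cong (B b) j+1≡col)
          (ℕ.<-trans descent (ℕ.<-trans (subst (B a j <_) (cong (λ z → B b (col d z)) swapShift-J+1) big)
            (asc-below b (isYes-witness (a ℕ.<? b) a<b) (in-col⇒above m (ℕ.n≤1+n J)))))))
    go (elsewhere t≢J t≢J+1) hook big =
      cong₂ _∧_
        (trans (inHook-j-swapped a b t) (trans (cong (inHookℕ d a J b) (swapShift-other t≢J t≢J+1))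
          (trans (hookJ-off a b t t≢J t≢J+1) (trans (sym (inHookℕ-off-col d≤J+1 a b t t≢J+1)) hook))))
        (isYes-true (B a (j + 1ℤ) ℕ.<? B b (col d t))
          (ℕ.<-trans descent (subst (B a j <_) (cong (λ z → B b (col d z)) (swapShift-other t≢J t≢J+1)) big)))

  -- Balance of B^# at (a, j) and (a, j+1) forces the two swapped counts to agree,
  -- whereas a descent B(a, j+1) < B(a, j) makes the one at (a, j) strictly larger.
  sharp-balanced⇒ascending : ∀ B → AllBalanced la⁺ (sharp la i B) → (∀ {x} → x ∈ boxes la → entry B x ≤ N) →
    (∀ a → 1 ≤ a → a < i → B a j ≢ B a (j + 1ℤ)) → ∀ a → 1 ≤ a → a < i → Ascending B a
  sharp-balanced⇒ascending B bal bounded distinct = downward-induction i step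
    where
    step : ∀ a → 1 ≤ a → a < i → (∀ b → a < b → b < i → Ascending B b) → Ascending B a
    step a 1≤a a<i asc-below with B a j ℕ.<? B a (j + 1ℤ)
    ... | yes asc = asc
    ... | no ¬asc = ⊥-elim (ℕ.<-irrefl refl (subst (λ z → suc z ≤ swappedLarger j (j + 1ℤ) B a) (sym counts≡) count<))
      where
      descent : B a (j + 1ℤ) < B a j
      descent = ℕ.≤∧≢⇒< (ℕ.≮⇒≥ ¬asc) (≢-sym (distinct a 1≤a a<i))
      counts≡ : swappedLarger j (j + 1ℤ) B a ≡ swappedLarger (j + 1ℤ) j B a
      counts≡ = ℕ.suc-injective (counts-from-ranks _ _ (rk la⁺ a (j + 1ℤ))
        (trans (cong (+_) (sym (largerCount-sharp-j B a a<i (bounded (col-j+1-∈ 1≤a a<i)))))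
               (trans (bal a j (boxes⁺-∈⁺ (inj₂ (col-j-∈ 1≤a a<i)))) (cong (_- 1ℤ) (rk-j la⁺ a))))
        (trans (cong (+_) (sym (largerCount-sharp-j+1 B a a<i))) (bal a (j + 1ℤ) (boxes⁺-∈⁺ (inj₂ (col-j+1-∈ 1≤a a<i))))))
      larger-j+1 : Box → Bool
      larger-j+1 x = inHook la a (j + 1ℤ) (swapBox x) ∧ ⌊ B a j ℕ.<? entry B x ⌋
      count< : suc (swappedLarger (j + 1ℤ) j B a) ≤ swappedLarger j (j + 1ℤ) B a
      count< = ℕ.≤-trans (ℕ.≤-reflexive (cong suc (count-swapBox larger-j+1)))
        (count-mono-< (λ x → larger-j+1 (swapBox x)) _ (boxes la) (a , j)
          (larger-j+1⇒larger-j B a a<i asc-below descent) (col-j-∈ 1≤a a<i)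
          (cong (_∧ ⌊ B a j ℕ.<? entry B (swapBox (a , j)) ⌋)
            (trans (cong (inHook la a (j + 1ℤ)) (swapBox-involutive (a , j)))
                (trans (inHook-j+1 a a J) (inHookℕ-prev-col d≤J a a))))
          (cong₂ _∧_ (trans (inHook-j-swapped a a J) (trans (cong (inHookℕ d a J a) swapShift-J)
                       (trans (inHookℕ-next-col d≤J a a) (isYes-true (a ℕ.≟ a) refl))))
                     (isYes-true (B a (j + 1ℤ) ℕ.<? B a j) descent)))

  swappedLarger-j : ∀ B a → Ascending B a → swappedLarger j (j + 1ℤ) B a ≡ largerInD la B a (j + 1ℤ)
  swappedLarger-j B a asc = count-cong _ _ (boxes la) pointwise
    where
    pointwise : ∀ x → x ∈ boxes la → (inHook la a j (swapBox x) ∧ ⌊ B a (j + 1ℤ) ℕ.<? entry B x ⌋)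
                                     ≡ (inHook la a (j + 1ℤ) x ∧ ⌊ B a (j + 1ℤ) ℕ.<? entry B x ⌋)
    pointwise (b , e) m with boxes-∈⁻ la m
    ... | cell t _ _ _ _ refl with shiftView t
    ... | at-J refl =
      trans (cong (_∧ V) (trans (inHook-j-swapped a b J)
          (trans (cong (inHookℕ d a J b) swapShift-J) (inHookℕ-next-col d≤J a b))))
            (trans same-row-smaller (cong (_∧ V) (sym (trans (inHook-j+1 a b J) (inHookℕ-prev-col d≤J a b)))))
      where
      V = ⌊ B a (j + 1ℤ) ℕ.<? B b j ⌋
      same-row-smaller : (⌊ b ℕ.≟ a ⌋ ∧ V) ≡ false
      same-row-smaller with toSum (b ℕ.≟ a)
      ... | inj₁ refl = trans (cong (⌊ b ℕ.≟ a ⌋ ∧_) (isYes-false (B a (j + 1ℤ) ℕ.<? B a j) (λ p → ℕ.<-asym p asc)))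
          (∧-zeroʳ _)
      ... | inj₂ b≢a  = cong (_∧ V) (isYes-false (b ℕ.≟ a) b≢a)
    ... | at-J+1 refl = cong (_∧ ⌊ B a (j + 1ℤ) ℕ.<? B b (col d (suc J)) ⌋)
      (trans (inHook-j-swapped a b (suc J)) (trans (cong (inHookℕ d a J b) swapShift-J+1)
        (trans (inHookℕ-same-col d≤J a b) (sym (trans (inHook-j+1 a b (suc J)) (inHookℕ-same-col d≤J+1 a b))))))
    ... | elsewhere t≢J t≢J+1 = cong (_∧ ⌊ B a (j + 1ℤ) ℕ.<? B b (col d t) ⌋)
      (trans (inHook-j-swapped a b t) (trans (cong (inHookℕ d a J b) (swapShift-other t≢J t≢J+1))
        (trans (hookJ-off a b t t≢J t≢J+1) (sym (trans (inHook-j+1 a b t) (inHookℕ-off-col d≤J+1 a b t t≢J+1))))))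

  -- Swapping back loses exactly the box (a, j+1) from the larger boxes of H(a, j).
  largerInD-j : ∀ B a → 1 ≤ a → a < i → Ascending B a → largerInD la B a j ≡ suc (swappedLarger (j + 1ℤ) j B a)
  largerInD-j B a 1≤a a<i asc = count-differ-at-one _ _ (boxes la) (a , j + 1ℤ) (boxes-unique la) (col-j+1-∈ 1≤a a<i)
    pointwise lost kept
    where
    lost : (inHook la a (j + 1ℤ) (swapBox (a , j + 1ℤ)) ∧ ⌊ B a j ℕ.<? B a (j + 1ℤ) ⌋) ≡ false
    lost = cong (_∧ ⌊ B a j ℕ.<? B a (j + 1ℤ) ⌋)
      (trans (cong (λ z → inHook la a (j + 1ℤ) (a , z)) swapCol-j+1) (trans (inHook-j+1 a a J) (inHookℕ-prev-col d≤J a a)))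
    kept : (inHook la a j (a , j + 1ℤ) ∧ ⌊ B a j ℕ.<? B a (j + 1ℤ) ⌋) ≡ true
    kept = cong₂ _∧_ (trans (cong (λ z → inHook la a j (a , z)) j+1≡col)
                       (trans (inHook-j a a (suc J)) (trans (inHookℕ-next-col d≤J a a) (isYes-true (a ℕ.≟ a) refl))))
                     (isYes-true (B a j ℕ.<? B a (j + 1ℤ)) asc)
    pointwise : ∀ x → x ∈ boxes la → x ≢ (a , j + 1ℤ) →
                (inHook la a j x ∧ ⌊ B a j ℕ.<? entry B x ⌋) ≡
                    (inHook la a (j + 1ℤ) (swapBox x) ∧ ⌊ B a j ℕ.<? entry B x ⌋)
    pointwise (b , e) m x≢ with boxes-∈⁻ la m
    ... | cell t _ _ _ _ refl = cong (_∧ ⌊ B a j ℕ.<? B b (col d t) ⌋) (hooks (shiftView t))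
      where
      hooks : ShiftView t → inHook la a j (b , col d t) ≡ inHook la a (j + 1ℤ) (swapBox (b , col d t))
      hooks (at-J refl) = trans (inHook-j a b J) (trans (inHookℕ-same-col d≤J a b)
        (sym (trans (inHook-j+1-swapped a b J) (trans (cong (inHookℕ d a (suc J) b) swapShift-J)
            (inHookℕ-same-col d≤J+1 a b)))))
      hooks (at-J+1 refl) = trans (inHook-j a b (suc J)) (trans (inHookℕ-next-col d≤J a b)
        (trans (isYes-false (b ℕ.≟ a) (λ b≡a → x≢ (cong₂ _,_ b≡a (sym j+1≡col))))
          (sym (trans (inHook-j+1-swapped a b (suc J))
              (trans (cong (inHookℕ d a (suc J) b) swapShift-J+1) (inHookℕ-prev-col d≤J a b))))))
      hooks (elsewhere t≢J t≢J+1) = trans (inHook-j a b t) (trans (hookJ-off a b t t≢J t≢J+1)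
        (sym (trans (inHook-j+1-swapped a b t) (trans (cong (inHookℕ d a (suc J) b) (swapShift-other t≢J t≢J+1))
          (inHookℕ-off-col d≤J+1 a b t t≢J+1)))))

  balanced-sharp-j⇔ : ∀ B a → a < i → Ascending B a → B a (j + 1ℤ) ≤ N →
                      Balanced la⁺ (sharp la i B) a j ⇔ Balanced la B a (j + 1ℤ)
  balanced-sharp-j⇔ B a a<i asc bound = balanced-transfer la⁺ (sharp la i B) a j la B a (j + 1ℤ) 1
    (trans (largerCount-sharp-j B a a<i bound)
           (cong suc (trans (swappedLarger-j B a asc) (sym (largerCount-nonneg la B a (j + 1ℤ) 0≤j+1)))))
    (trans (rk⁺-other-row a j (λ a≡i → ℕ.<-irrefl a≡i a<i) 0≤j) (rk-j la a))

  balanced-sharp-j+1⇔ : ∀ B a → 1 ≤ a → a < i → Ascending B a →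
                        Balanced la⁺ (sharp la i B) a (j + 1ℤ) ⇔ Balanced la B a j
  balanced-sharp-j+1⇔ B a 1≤a a<i asc = ⇔.sym (balanced-transfer la B a j la⁺ (sharp la i B) a (j + 1ℤ) 1
    (trans (largerCount-nonneg la B a j 0≤j) (trans (largerInD-j B a 1≤a a<i asc)
        (cong suc (sym (largerCount-sharp-j+1 B a a<i)))))
    (trans (rk-j la a) (cong (_+ 1ℤ) (sym (rk⁺-other-row a (j + 1ℤ) (λ a≡i → ℕ.<-irrefl a≡i a<i) 0≤j+1)))))

  inHook-swap-invariant : ∀ a s → s ≢ J → s ≢ suc J → ∀ {x} → x ∈ boxes la →
                          inHook la a (col d s) (swapBox x) ≡ inHook la a (col d s) x
  inHook-swap-invariant a s s≢J s≢J+1 {b , e} m with boxes-∈⁻ la m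
  ... | cell t _ _ _ _ refl = trans (cong (λ z → inHook la a (col d s) (b , z)) (swapCol-col t))
      (trans (inHook-col la a s b (swapShift t)) (trans (swapped (shiftView t)) (sym (inHook-col la a s b t))))
    where
    swapped : ShiftView t → inHookℕ d a s b (swapShift t) ≡ inHookℕ d a s b t
    swapped (at-J refl)   = trans (cong (inHookℕ d a s b) swapShift-J) (sym (inHookℕ-swap-cols d a s b J s≢J s≢J+1))
    swapped (at-J+1 refl) = trans (cong (inHookℕ d a s b) swapShift-J+1) (inHookℕ-swap-cols d a s b J s≢J s≢J+1)
    swapped (elsewhere t≢J t≢J+1) = cong (inHookℕ d a s b) (swapShift-other t≢J t≢J+1)

  new-in-hook-nonneg : ∀ {a s} → (a , col d s) ∈ boxes la → d ≤ s → s ≢ J → inHookℕ d a s i J ≡ ⌊ a ℕ.≟ i ⌋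
  new-in-hook-nonneg {a} {s} m d≤s s≢J = trans (inHookℕ-off-col d≤s a i J (≢-sym s≢J)) same-row
    where
    same-row : inArm a s i J ≡ ⌊ a ℕ.≟ i ⌋
    same-row with toSum (a ℕ.≟ i)
    ... | inj₁ refl = trans (cong (_∧ ⌊ s ℕ.≤? J ⌋) (isYes-true (a ℕ.≟ a) refl))
        (trans (isYes-true (s ℕ.≤? J) (ℕ.<⇒≤ (in-row-i⇒before-J m))) (sym (isYes-true (a ℕ.≟ a) refl)))
    ... | inj₂ a≢i = trans (cong (_∧ ⌊ s ℕ.≤? J ⌋) (isYes-false (i ℕ.≟ a) (≢-sym a≢i)))
                           (sym (isYes-false (a ℕ.≟ i) a≢i))

  -- In a negative column the new box can also enter through the full row d+1−j;
  -- the two ways exclude each other since a ≤ s < s+1.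
  new-in-hook-neg : ∀ {a s} → (a , col d s) ∈ boxes la → ¬ d ≤ s → s ≢ J →
                    indicator (inHookℕ d a s i J) ≡ indicator ⌊ a ℕ.≟ i ⌋ ℕ.+ indicator ⌊ suc s ℕ.≟ i ⌋
  new-in-hook-neg {a} {s} m d≰s s≢J with boxes-∈⁻ la m
  ... | cell s′ _ _ a≤s′ _ e with col-injective d e
  ... | refl = begin
    indicator (inHookℕ d a s i J)
      ≡⟨ cong indicator (if-false (isYes-false (d ℕ.≤? s) d≰s)) ⟩
    indicator (inArm a s i J ∨ (inLeg a s i J ∨ ⌊ i ℕ.≟ suc s ⌋))
      ≡⟨ cong (λ u → indicator (inArm a s i J ∨ (u ∧ ⌊ a ℕ.<? i ⌋ ∨ ⌊ i ℕ.≟ suc s ⌋)))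
              (isYes-false (J ℕ.≟ s) (≢-sym s≢J)) ⟩
    indicator (inArm a s i J ∨ ⌊ i ℕ.≟ suc s ⌋)
      ≡⟨ cong (λ u → indicator ((u ∧ ⌊ s ℕ.≤? J ⌋) ∨ ⌊ i ℕ.≟ suc s ⌋)) (≟-comm i a) ⟩
    indicator ((⌊ a ℕ.≟ i ⌋ ∧ ⌊ s ℕ.≤? J ⌋) ∨ ⌊ i ℕ.≟ suc s ⌋)
      ≡⟨ cong (λ u → indicator ((⌊ a ℕ.≟ i ⌋ ∧ u) ∨ ⌊ i ℕ.≟ suc s ⌋))
              (isYes-true (s ℕ.≤? J) (ℕ.<⇒≤ (ℕ.<-trans (ℕ.≰⇒> d≰s) d<J))) ⟩
    indicator ((⌊ a ℕ.≟ i ⌋ ∧ true) ∨ ⌊ i ℕ.≟ suc s ⌋)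
      ≡⟨ cong (λ u → indicator (u ∨ ⌊ i ℕ.≟ suc s ⌋)) (∧-identityʳ _) ⟩
    indicator (⌊ a ℕ.≟ i ⌋ ∨ ⌊ i ℕ.≟ suc s ⌋)
      ≡⟨ indicator-∨ _ _ exclusive ⟩
    indicator ⌊ a ℕ.≟ i ⌋ ℕ.+ indicator ⌊ i ℕ.≟ suc s ⌋
      ≡⟨ cong (λ u → indicator ⌊ a ℕ.≟ i ⌋ ℕ.+ indicator u) (≟-comm i (suc s)) ⟩
    indicator ⌊ a ℕ.≟ i ⌋ ℕ.+ indicator ⌊ suc s ℕ.≟ i ⌋ ∎
    where
    open ≡-Reasoning
    ≟-comm : ∀ x y → ⌊ x ℕ.≟ y ⌋ ≡ ⌊ y ℕ.≟ x ⌋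
    ≟-comm x y = isYes-cong (mk⇔ sym sym) _ _
    indicator-∨ : ∀ u v → (u ≡ true → v ≡ false) → indicator (u ∨ v) ≡ indicator u ℕ.+ indicator v
    indicator-∨ true  v excl rewrite excl refl = refl
    indicator-∨ false v excl = refl
    exclusive : ⌊ a ℕ.≟ i ⌋ ≡ true → ⌊ i ℕ.≟ suc s ⌋ ≡ false
    exclusive a≡i with isYes-witness (a ℕ.≟ i) a≡i
    ... | refl = isYes-false (a ℕ.≟ suc s) (λ a≡s+1 → ℕ.<-irrefl a≡s+1 (s≤s a≤s′))

  rk⁺-nonneg-col : ∀ a s → d ≤ s → rk la⁺ a (col d s) ≡ rk la a (col d s) + + indicator ⌊ a ℕ.≟ i ⌋
  rk⁺-nonneg-col a s d≤s = begin
    rk la⁺ a c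
      ≡⟨ rk-nonneg la⁺ a c 0≤c ⟩
    + part la⁺ a - + length la⁺ + + a - c
      ≡⟨ cong₂ (λ u v → + u - + v + + a - c) (part⁺ a) length-la⁺ ⟩
    + (part la a ℕ.+ ka) - + d + + a - c
      ≡⟨ cong (λ w → w - + d + + a - c) (ℤ.pos-+ (part la a) ka) ⟩
    (+ part la a + + ka) - + d + + a - c
      ≡⟨ ring (+ part la a) (+ ka) (+ d) (+ a) c ⟩
    (+ part la a - + d + + a - c) + + ka
      ≡⟨ cong (_+ + ka) (sym (rk-nonneg la a c 0≤c)) ⟩
    rk la a c + + ka ∎
    where
    open ≡-Reasoning
    c = col d s
    ka = indicator ⌊ a ℕ.≟ i ⌋
    0≤c = trans (isYes-0≤col d s) (isYes-true (d ℕ.≤? s) d≤s)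
    ring : ∀ (La k dd a c : ℤ) → (La + k) - dd + a - c ≡ (La - dd + a - c) + k
    ring = solve-∀

  rk⁺-neg-col : ∀ a s → ¬ d ≤ s →
    rk la⁺ a (col d s) ≡ rk la a (col d s) + (+ indicator ⌊ a ℕ.≟ i ⌋ + + indicator ⌊ suc s ℕ.≟ i ⌋)
  rk⁺-neg-col a s d≰s = begin
    rk la⁺ a c
      ≡⟨ rk-neg la⁺ a c c<0 ⟩
    + part la⁺ a - + length la⁺ + + a + + part la⁺ (ℤ.∣ + suc (length la⁺) + c ∣) + c + 1ℤ
      ≡⟨ cong₂ (λ u v → + u - + v + + a + + part la⁺ (ℤ.∣ + suc v + c ∣) + c + 1ℤ) (part⁺ a) length-la⁺ ⟩
    + (part la a ℕ.+ ka) - + d + + a + + part la⁺ (ℤ.∣ + suc d + c ∣) + c + 1ℤ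
      ≡⟨ cong (λ w → + (part la a ℕ.+ ka) - + d + + a + + part la⁺ w + c + 1ℤ) (cong ℤ.∣_∣ (suc-d+col d s)) ⟩
    + (part la a ℕ.+ ka) - + d + + a + + part la⁺ (suc s) + c + 1ℤ
      ≡⟨ cong (λ w → + (part la a ℕ.+ ka) - + d + + a + + w + c + 1ℤ) (part⁺ (suc s)) ⟩
    + (part la a ℕ.+ ka) - + d + + a + + (part la (suc s) ℕ.+ ks) + c + 1ℤ
      ≡⟨ cong₂ (λ u v → u - + d + + a + v + c + 1ℤ) (ℤ.pos-+ (part la a) ka) (ℤ.pos-+ (part la (suc s)) ks) ⟩
    (+ part la a + + ka) - + d + + a + (+ part la (suc s) + + ks) + c + 1ℤ
      ≡⟨ ring (+ part la a) (+ ka) (+ d) (+ a) (+ part la (suc s)) (+ ks) c ⟩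
    (+ part la a - + d + + a + + part la (suc s) + c + 1ℤ) + (+ ka + + ks)
      ≡⟨ cong (_+ (+ ka + + ks)) (sym (trans (rk-neg la a c c<0)
           (cong (λ w → + part la a - + d + + a + + part la w + c + 1ℤ) (cong ℤ.∣_∣ (suc-d+col d s))))) ⟩
    rk la a c + (+ ka + + ks) ∎
    where
    open ≡-Reasoning
    c = col d s
    ka = indicator ⌊ a ℕ.≟ i ⌋
    ks = indicator ⌊ suc s ℕ.≟ i ⌋
    c<0 = trans (isYes-0≤col d s) (isYes-false (d ℕ.≤? s) d≰s)
    ring : ∀ (La ka dd a Ls ks c : ℤ) →
           (La + ka) - dd + a + (Ls + ks) + c + 1ℤ ≡ (La - dd + a + Ls + c + 1ℤ) + (ka + ks)
    ring = solve-∀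

  rk⁺-other-col : ∀ a s → (a , col d s) ∈ boxes la → s ≢ J →
                  rk la⁺ a (col d s) ≡ rk la a (col d s) + + indicator (inHookℕ d a s i J)
  rk⁺-other-col a s m s≢J with toSum (d ℕ.≤? s)
  ... | inj₁ d≤s = trans (rk⁺-nonneg-col a s d≤s)
                         (cong (λ w → rk la a (col d s) + + indicator w) (sym (new-in-hook-nonneg m d≤s s≢J)))
  ... | inj₂ d≰s = trans (rk⁺-neg-col a s d≰s) (cong (λ w → rk la a (col d s) + w)
                         (trans (sym (ℤ.pos-+ (indicator ⌊ a ℕ.≟ i ⌋) _)) (cong (+_) (sym (new-in-hook-neg m d≰s s≢J)))))

  largerCount-sharp-other : ∀ B a s → s ≢ J → s ≢ suc J → B a (col d s) ≤ N →
    largerCount la⁺ (sharp la i B) a (col d s) ≡ indicator (inHookℕ d a s i J) ℕ.+ largerCount la B a (col d s)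
  largerCount-sharp-other B a s s≢J s≢J+1 bound = begin
    largerCount la⁺ T a c
      ≡⟨ largerCount-split la⁺ T a c ⟩
    largerInD la⁺ T a c ℕ.+ largerExtra la⁺ T a c
      ≡⟨ cong₂ ℕ._+_ (largerInD⁺ T a c) (largerExtra-cong la⁺ la T B a c length-la⁺ T≡B
                       (λ r → sharp-outside B r 0ℤ 0≢j 0≢j+1) (λ r → sharp-outside B r c c≢j c≢j+1)) ⟩
    (indicator (inHook la a c (i , j) ∧ ⌊ T a c ℕ.<? T i j ⌋) ℕ.+ largerInD la T a c) ℕ.+ largerExtra la B a c
      ≡⟨ cong (ℕ._+ largerExtra la B a c) (cong₂ ℕ._+_ (cong indicator new-box) old-boxes) ⟩
    (k ℕ.+ largerInD la B a c) ℕ.+ largerExtra la B a c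
      ≡⟨ ℕ.+-assoc k _ _ ⟩
    k ℕ.+ (largerInD la B a c ℕ.+ largerExtra la B a c)
      ≡⟨ cong (k ℕ.+_) (sym (largerCount-split la B a c)) ⟩
    k ℕ.+ largerCount la B a c ∎
    where
    open ≡-Reasoning
    T = sharp la i B
    c = col d s
    k = indicator (inHookℕ d a s i J)
    c≢j : c ≢ j
    c≢j e = s≢J (col-injective d e)
    c≢j+1 : c ≢ j + 1ℤ
    c≢j+1 e = s≢J+1 (col-injective d (trans e j+1≡col))
    T≡B : T a c ≡ B a c
    T≡B = sharp-outside B a c c≢j c≢j+1
    new-box : (inHook la a c (i , j) ∧ ⌊ T a c ℕ.<? T i j ⌋) ≡ inHookℕ d a s i J
    new-box = trans (cong₂ _∧_ (inHook-col la a s i J)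
                               (isYes-true (T a c ℕ.<? T i j) (subst₂ _<_ (sym T≡B) (sym (sharp-new B)) (s≤s bound))))
                    (∧-identityʳ _)
    old-boxes : largerInD la T a c ≡ largerInD la B a c
    old-boxes = trans (largerInD-sharp B a c (T a c))
      (trans (cong (λ v → count (λ x → inHook la a c (swapBox x) ∧ ⌊ v ℕ.<? entry B x ⌋) (boxes la)) T≡B)
             (count-cong _ _ (boxes la) λ x m →
                cong (_∧ ⌊ B a c ℕ.<? entry B x ⌋) (inHook-swap-invariant a s s≢J s≢J+1 m)))

  balanced-sharp-other⇔ : ∀ B a s → (a , col d s) ∈ boxes la → s ≢ J → s ≢ suc J → B a (col d s) ≤ N →
                          Balanced la⁺ (sharp la i B) a (col d s) ⇔ Balanced la B a (col d s)
  balanced-sharp-other⇔ B a s m s≢J s≢J+1 bound =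
    balanced-transfer la⁺ (sharp la i B) a (col d s) la B a (col d s) (indicator (inHookℕ d a s i J))
      (largerCount-sharp-other B a s s≢J s≢J+1 bound) (rk⁺-other-col a s m s≢J)

  entries-bounded : ∀ B → map (entry B) (boxes la) ↭ applyUpTo suc N → ∀ {x} → x ∈ boxes la → entry B x ≤ N
  entries-bounded B perm m with ∈-applyUpTo⁻ suc (↭.∈-resp-↭ perm (∈-map⁺ (entry B) m))
  ... | k , k<N , e = subst (_≤ N) (sym e) k<N

  entries⁺-↭ : applyUpTo suc (size la⁺) ↭ suc N ∷ applyUpTo suc N
  entries⁺-↭ = ↭-sym (↭-trans (↭.∷↭∷ʳ (suc N) (applyUpTo suc N))
    (↭.↭-reflexive (trans (applyUpTo-∷ʳ suc N) (cong (applyUpTo suc) (sym (size-incAt la i 1≤i i≤d))))))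

  entries-distinct : ∀ B → map (entry B) (boxes la) ↭ applyUpTo suc N → ∀ a → 1 ≤ a → a < i → B a j ≢ B a (j + 1ℤ)
  entries-distinct B perm a 1≤a a<i e = j≢j+1 (cong proj₂ (unique-map⇒injective-on (entry B) (boxes la)
    (Unique-resp-↭ (↭-sym perm) (Unique.applyUpTo⁺₁ suc N (λ x<y _ e → ℕ.<⇒≢ x<y (ℕ.suc-injective e))))
    (col-j-∈ 1≤a a<i) (col-j+1-∈ 1≤a a<i) e))

  balanced⇒sharp-balanced : ∀ B → map (entry B) (boxes la) ↭ applyUpTo suc N → AllBalanced la B →
                            AllBalanced la⁺ (sharp la i B)
  balanced⇒sharp-balanced B perm bal a c m with boxes⁺-∈⁻ m
  ... | inj₁ refl = balanced-new B
  ... | inj₂ m′ with boxes-∈⁻ la m′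
  ... | cell s 1≤a a≤d _ s<end refl with shiftView s
  ... | at-J refl =
    Equivalence.from (balanced-sharp-j⇔ B a a<i (ascending a 1≤a a<i) (entries-bounded B perm (col-j+1-∈ 1≤a a<i)))
                     (bal a (j + 1ℤ) (col-j+1-∈ 1≤a a<i))
    where
    ascending = balanced⇒ascending B bal
    a<i = reaches-J⇒above a≤d s<end ℕ.≤-refl
  ... | at-J+1 refl = subst (Balanced la⁺ (sharp la i B) a) j+1≡col
    (Equivalence.from (balanced-sharp-j+1⇔ B a 1≤a a<i (balanced⇒ascending B bal a 1≤a a<i)) (bal a j (col-j-∈ 1≤a a<i)))
    where a<i = reaches-J⇒above a≤d s<end (ℕ.n≤1+n J)
  ... | elsewhere s≢J s≢J+1 =
    Equivalence.from (balanced-sharp-other⇔ B a s m′ s≢J s≢J+1 (entries-bounded B perm m′)) (bal a (col d s) m′)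

  sharp-balanced⇒balanced : ∀ B → map (entry B) (boxes la) ↭ applyUpTo suc N → AllBalanced la⁺ (sharp la i B) →
                            AllBalanced la B
  sharp-balanced⇒balanced B perm bal⁺ a c m with boxes-∈⁻ la m
  ... | cell s 1≤a a≤d _ s<end refl with shiftView s
  ... | at-J refl = Equivalence.to (balanced-sharp-j+1⇔ B a 1≤a a<i (ascending a 1≤a a<i))
                                   (bal⁺ a (j + 1ℤ) (boxes⁺-∈⁺ (inj₂ (col-j+1-∈ 1≤a a<i))))
    where
    ascending = sharp-balanced⇒ascending B bal⁺ (entries-bounded B perm) (entries-distinct B perm)
    a<i = reaches-J⇒above a≤d s<end ℕ.≤-refl
  ... | at-J+1 refl = subst (Balanced la B a) j+1≡col
    (Equivalence.to (balanced-sharp-j⇔ B a a<i (ascending a 1≤a a<i) (entries-bounded B perm (col-j+1-∈ 1≤a a<i)))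
                    (bal⁺ a j (boxes⁺-∈⁺ (inj₂ (col-j-∈ 1≤a a<i)))))
    where
    ascending = sharp-balanced⇒ascending B bal⁺ (entries-bounded B perm) (entries-distinct B perm)
    a<i = reaches-J⇒above a≤d s<end (ℕ.n≤1+n J)
  ... | elsewhere s≢J s≢J+1 = Equivalence.to (balanced-sharp-other⇔ B a s m s≢J s≢J+1 (entries-bounded B perm m))
                                             (bal⁺ a (col d s) (boxes⁺-∈⁺ (inj₂ m)))

  sharp-BS : ∀ B → BS la B → BS la⁺ (sharp la i B)
  sharp-BS B (perm , bal) =
    ↭-trans (sharp-entries-↭ B) (↭-trans (prep (suc N) perm) (↭-sym entries⁺-↭)) , balanced⇒sharp-balanced B perm bal

  sharp-injective : ∀ B B′ → sharp la i B ≈[ la⁺ ] sharp la i B′ → B ≈[ la ] B′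
  sharp-injective B B′ B⁺≈B′⁺ a c m =
    trans (sym (sharp-swapBox B m)) (trans (B⁺≈B′⁺ a (swapCol c) (boxes⁺-∈⁺ (inj₂ (swapBox-∈ m)))) (sharp-swapBox B′ m))

  unsharp : Filling → Filling
  unsharp T a e = T a (swapCol e)

  sharp-unsharp : ∀ T → T i j ≡ suc N → ∀ a e → sharp la i (unsharp T) a e ≡ T a e
  sharp-unsharp T new a e with toSum (a ℕ.≟ i) | toSum (e ℤ.≟ j)
  ... | inj₁ refl | inj₁ refl = trans (sharp-new (unsharp T)) (sym new)
  ... | inj₁ _    | inj₂ e≢j  = trans (sharp-swapped (unsharp T) a e (λ p → e≢j (proj₂ p))) (cong (T a) (swapCol-involutive e))
  ... | inj₂ a≢i  | _         = trans (sharp-swapped (unsharp T) a e (λ p → a≢i (proj₁ p))) (cong (T a) (swapCol-involutive e))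

  sharp-surjective : ∀ T → BS la⁺ T → T i j ≡ suc N → Σ Filling (λ B → BS la B × sharp la i B ≈[ la⁺ ] T)
  sharp-surjective T (perm⁺ , bal⁺) new =
    B , (perm , sharp-balanced⇒balanced B perm sharp-bal) , λ a c _ → sharp-unsharp T new a c
    where
    B = unsharp T
    sharp-perm : map (entry (sharp la i B)) (boxes la⁺) ↭ applyUpTo suc (size la⁺)
    sharp-perm = subst (_↭ applyUpTo suc (size la⁺))
      (sym (map-cong-local (All.tabulate {xs = boxes la⁺} λ {x} _ → sharp-unsharp T new (proj₁ x) (proj₂ x)))) perm⁺
    perm : map (entry B) (boxes la) ↭ applyUpTo suc N
    perm = ↭.drop-∷ (↭-trans (↭-sym (sharp-entries-↭ B)) (↭-trans sharp-perm entries⁺-↭))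
    sharp-bal : AllBalanced la⁺ (sharp la i B)
    sharp-bal a c m = trans (cong (+_) (largerCount-cong la⁺ _ _ (sharp-unsharp T new) a c)) (bal⁺ a c m)

open import Defs
open import Data.Nat using (ℕ; suc; _≤_; _+_; _∸_)
open import Data.List using (List; length)
open import Data.Product using (_×_; Σ; _,_)
open import Data.Sum using (_⊎_)
open import Relation.Binary.PropositionalEquality using (_≡_; subst; sym)

lemma5p10 : (la : List ℕ) → Strict la → (i : ℕ) → 1 ≤ i → i ≤ length la
    → (i ≡ 1 ⊎ part la i + 3 ≤ part la (i ∸ 1))
    → ((B : Filling) → BS la B
         → BS (incAt la i) (sharp la i B) × sharp la i B i (newCol la i) ≡ suc (size la))
      × ((B B' : Filling) → BS la B → BS la B'
         → sharp la i B ≈[ incAt la i ] sharp la i B' → B ≈[ la ] B')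
      × ((T : Filling) → BS (incAt la i) T → T i (newCol la i) ≡ suc (size la)
         → Σ Filling (λ B → BS la B × sharp la i B ≈[ incAt la i ] T))
lemma5p10 la st i 1≤i i≤d gap =
    (λ B B∈BS → sharp-BS B B∈BS , subst (λ c → sharp la i B i c ≡ suc N) (sym newCol≡j) (sharp-new B))
  , (λ B B′ _ _ → sharp-injective B B′)
  , (λ T T∈BS new → sharp-surjective T T∈BS (subst (λ c → T i c ≡ suc N) newCol≡j new))
  where
  open ColumnSwap la st i 1≤i i≤d gap
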